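{- For $r = 0, 1, 2$, \[ [t^r] \sum_{\lambda\in \mathcal{P}}\prod_{i\geq 1}\left[{\lambda_i-\lambda_{i+2}+1 \atop \lambda_{i+1}-\lambda_{i+2}}\right]_{t}q^{\binom{\lambda_1}{2}+|\lambda|}= [t^r] \prod_{i\geq 1}\frac{1}{(1-q^{2i-1})(1-tq^{2i})}. \]
   Context: $\mathcal{P}$ is the set of all partitions $\lambda=(\lambda_1\ge\lambda_2\ge\cdots)$, with $\lambda_i=0$ beyond the last nonzero part, and $|\lambda|=\sum\lambda_i$. $\left[{a\atop b}\right]_t$ is the Gaussian $t$-binomial coefficient. For a power series $Q$ in $t$ (with coefficients power series in $q$), $[t^r]Q$ denotes the coefficient of $t^r$. -}

module Defs where

open import Data.Nat using (ℕ; zero; suc; _+_; _*_; _∸_; _≤ᵇ_; _≡ᵇ_)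
open import Data.Nat.Combinatorics using (_C_)
open import Data.List using (List; []; _∷_; _++_; map; concatMap; length)
open import Data.Nat.ListAction using (sum)
open import Data.Bool using (Bool; true; false; if_then_else_; _∧_)

Σ≤ : ℕ → (ℕ → ℕ) → ℕ
Σ≤ zero    f = f 0
Σ≤ (suc n) f = Σ≤ n f + f (suc n)

-- Power series in t (coefficients in ℕ), as coefficient functions:
-- f r = [t^r] f

TSeries : Set
TSeries = ℕ → ℕ

oneT : TSeries
oneT zero    = 1
oneT (suc _) = 0

_⊛_ : TSeries → TSeries → TSeries
(f ⊛ g) r = Σ≤ r (λ j → f j * g (r ∸ j))

-- Gaussian t-binomial [n choose k]_t, via the t-Pascal rule
-- [n+1, k+1] = [n, k] + t^(k+1) [n, k+1]   (and [n,0] = 1, [0,k+1] = 0)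
gauss : ℕ → ℕ → TSeries
gauss zero    zero    = oneT
gauss zero    (suc k) = λ _ → 0
gauss (suc n) zero    = oneT
gauss (suc n) (suc k) r =
  gauss n k r + (if suc k ≤ᵇ r then gauss n (suc k) (r ∸ suc k) else 0)

-- Partitions, as weakly decreasing lists of positive parts
-- λ = (λ₁ ≥ λ₂ ≥ ... ), with λᵢ = 0 beyond the last part.

-- part λ i = λ_(i+1)   (0-indexed access; 0 beyond the end)
part : List ℕ → ℕ → ℕ
part []       _       = 0
part (x ∷ _)  zero    = x
part (_ ∷ xs) (suc i) = part xs i

size : List ℕ → ℕ
size = sum

range1 : ℕ → List ℕ
range1 zero    = []
range1 (suc k) = range1 k ++ (suc k ∷ [])

-- decLists f k : all weakly decreasing lists of positive integers,
-- each part ≤ k, of length ≤ f (each listed exactly once).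
-- In particular decLists n n contains every partition λ with |λ| ≤ n.
decLists : ℕ → ℕ → List (List ℕ)
decLists zero    k = [] ∷ []
decLists (suc f) k = [] ∷ concatMap (λ j → map (j ∷_) (decLists f j)) (range1 k)

weight : List ℕ → ℕ
weight lam = (part lam 0 C 2) + size lam

-- ∏_{i ≥ 1} [λᵢ - λ_{i+2} + 1 choose λ_{i+1} - λ_{i+2}]_t .
-- Factors with i > length λ equal [1 choose 0]_t = 1, so the product
-- over i = 1 .. length λ is the full product.
gaussFactor : List ℕ → ℕ → TSeries
gaussFactor lam i =
  gauss (part lam i ∸ part lam (suc (suc i)) + 1)
        (part lam (suc i) ∸ part lam (suc (suc i)))

prodUpTo : List ℕ → ℕ → TSeries
prodUpTo lam zero    = oneT
prodUpTo lam (suc m) = prodUpTo lam m ⊛ gaussFactor lam m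

prodGauss : List ℕ → TSeries
prodGauss lam = prodUpTo lam (length lam)

-- [q^n t^r] Σ_{λ ∈ 𝒫} ∏_i [...]_t q^{binom(λ₁,2)+|λ|}
-- (only partitions with |λ| ≤ n can contribute to q^n)
lhsCoeff : ℕ → ℕ → ℕ
lhsCoeff n r =
  sum (map (λ lam → if weight lam ≡ᵇ n then prodGauss lam r else 0)
           (decLists n n))

-- Right-hand side: power series in q and t,  f n r = [q^n t^r] f

QTSeries : Set
QTSeries = ℕ → ℕ → ℕ

oneQT : QTSeries
oneQT zero    zero    = 1
oneQT _       _       = 0

_⊠_ : QTSeries → QTSeries → QTSeries
(f ⊠ g) n r = Σ≤ n (λ a → Σ≤ r (λ b → f a b * g (n ∸ a) (r ∸ b)))

-- geo e s = 1 / (1 - t^s q^e) = Σ_k t^(k s) q^(k e)   (used with e ≥ 1,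
-- so only k ≤ n can contribute to q^n)
geo : ℕ → ℕ → QTSeries
geo e s n r = Σ≤ n (λ k → if (k * e ≡ᵇ n) ∧ (k * s ≡ᵇ r) then 1 else 0)

rhsProd : ℕ → QTSeries
rhsProd zero    = oneQT
rhsProd (suc j) = rhsProd j ⊠ (geo (suc (2 * j)) 0 ⊠ geo (2 * suc j) 1)

-- [q^n t^r] ∏_{i ≥ 1} 1/((1-q^(2i-1))(1-t q^(2i))) : factors with i > n
-- are ≡ 1 mod q^(n+1), so the truncation at N = n gives the coefficient.
rhsCoeff : ℕ → ℕ → ℕ
rhsCoeff n r = rhsProd n n r

module Submission where

-- Right-hand side.  [t^r] ∏ 1/(1 - t q^(2i)) is h_r(q², q⁴, …), so the
-- t⁰, t¹, t² coefficients are 1/(q;q²)_∞ times 1, q²/(1-q²) and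
-- q⁴/((1-q²)(1-q⁴)); up to degree n only the first n factors matter.
--
-- Euler's identity.  With E_k = Σ_m q^(m(m+1)/2 + km)/(q)_m one has
-- E_k = (1 + q^(k+1)) E_(k+1), hence E_0 = (-q;q)_∞ = 1/(q;q²)_∞.
--
-- Grouping partitions by their largest part m gives
-- [t^r] LHS = Σ_m q^(m(m+1)/2) A_r(m, m), where A_r(p, k) sums the
-- contributions of the partitions τ with parts ≤ k lying below a part p.
-- The t⁰, t¹, t² coefficients of the Gaussian factors are explicit, so
-- removing the largest part of τ yields recursions in k which pin down
-- A_0, A_1, A_2 in closed form.  Summing these with Euler's recursion gives
-- [t^r] LHS = h_r(q², q⁴, …) · E_0 for r = 0, 1, 2, and the theorem
-- follows by comparing with the right-hand side.

open import Defs
open import Data.Nat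
open import Data.Nat.Properties
open import Data.Nat.Combinatorics using (_C_; nC1≡n; nCk+nC[k+1]≡[n+1]C[k+1])
open import Data.Nat.ListAction using (sum)
open import Data.Nat.Tactic.RingSolver using (solve-∀)
open import Data.Bool using (Bool; true; false; if_then_else_; _∧_)
open import Data.Bool.Properties using (∧-identityʳ; ∧-zeroʳ)
open import Data.List using (List; []; _∷_; _++_; map; concatMap; length)
open import Data.List.Properties using (concatMap-++)
open import Data.Product using (_×_; _,_; proj₁; proj₂)
open import Relation.Binary.PropositionalEquality hiding ([_])
open import Relation.Nullary using (yes; no; Dec)
open import Relation.Nullary.Negation using (contradiction)
open import Relation.Nullary.Decidable using (dec-true; dec-false; does-⇔)
open import Function.Bundles using (mk⇔)
open import Data.Nat.Induction using (<-rec)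
open import Algebra.Bundles using (CommutativeSemiring)
open import Relation.Binary.Structures using (IsEquivalence)
open import Algebra.Structures.Biased using (isCommutativeSemiringˡ)
import Relation.Binary.Reasoning.Setoid as SetoidReasoning

-- Power series in q with coefficients in ℕ

Series : Set
Series = ℕ → ℕ

infix 4 _≋_
_≋_ : Series → Series → Set
f ≋ g = ∀ n → f n ≡ g n

≋-refl : ∀ {f} → f ≋ f
≋-refl n = refl

≋-sym : ∀ {f g} → f ≋ g → g ≋ f
≋-sym p n = sym (p n)

≋-trans : ∀ {f g h} → f ≋ g → g ≋ h → f ≋ h
≋-trans p q n = trans (p n) (q n)

infixl 6 _⊕_
_⊕_ : Series → Series → Series
(f ⊕ g) n = f n + g n

0S : Series
0S _ = 0

Σ≤-cong : ∀ n {f g : ℕ → ℕ} → (∀ j → j ≤ n → f j ≡ g j) → Σ≤ n f ≡ Σ≤ n g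
Σ≤-cong zero    h = h 0 z≤n
Σ≤-cong (suc n) h =
  cong₂ _+_ (Σ≤-cong n (λ j p → h j (m≤n⇒m≤1+n p))) (h (suc n) ≤-refl)

Σ≤-cong′ : ∀ n {f g : ℕ → ℕ} → (∀ j → f j ≡ g j) → Σ≤ n f ≡ Σ≤ n g
Σ≤-cong′ n h = Σ≤-cong n (λ j _ → h j)

Σ≤-zero : ∀ n {f : ℕ → ℕ} → (∀ j → j ≤ n → f j ≡ 0) → Σ≤ n f ≡ 0
Σ≤-zero zero    h = h 0 z≤n
Σ≤-zero (suc n) h =
  cong₂ _+_ (Σ≤-zero n (λ j p → h j (m≤n⇒m≤1+n p))) (h (suc n) ≤-refl)

Σ≤-+ : ∀ n (f g : ℕ → ℕ) → Σ≤ n (λ j → f j + g j) ≡ Σ≤ n f + Σ≤ n g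
Σ≤-+ zero    f g = refl
Σ≤-+ (suc n) f g =
  trans (cong (_+ (f (suc n) + g (suc n))) (Σ≤-+ n f g))
        (interchange (Σ≤ n f) (Σ≤ n g) (f (suc n)) (g (suc n)))
  where
  interchange : ∀ a b c d → (a + b) + (c + d) ≡ (a + c) + (b + d)
  interchange = solve-∀

Σ≤-*ˡ : ∀ n c (f : ℕ → ℕ) → c * Σ≤ n f ≡ Σ≤ n (λ j → c * f j)
Σ≤-*ˡ zero    c f = refl
Σ≤-*ˡ (suc n) c f =
  trans (*-distribˡ-+ c (Σ≤ n f) (f (suc n))) (cong (_+ c * f (suc n)) (Σ≤-*ˡ n c f))

Σ≤-*ʳ : ∀ n c (f : ℕ → ℕ) → Σ≤ n f * c ≡ Σ≤ n (λ j → f j * c)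
Σ≤-*ʳ n c f = trans (*-comm (Σ≤ n f) c)
  (trans (Σ≤-*ˡ n c f) (Σ≤-cong′ n (λ j → *-comm c (f j))))

Σ≤-shift : ∀ n (f : ℕ → ℕ) → Σ≤ (suc n) f ≡ f 0 + Σ≤ n (λ j → f (suc j))
Σ≤-shift zero    f = refl
Σ≤-shift (suc n) f =
  trans (cong (_+ f (suc (suc n))) (Σ≤-shift n f))
        (+-assoc (f 0) (Σ≤ n (λ j → f (suc j))) (f (suc (suc n))))

Σ≤-swap : ∀ n m (f : ℕ → ℕ → ℕ) →
  Σ≤ n (λ a → Σ≤ m (λ b → f a b)) ≡ Σ≤ m (λ b → Σ≤ n (λ a → f a b))
Σ≤-swap zero    m f = refl
Σ≤-swap (suc n) m f =
  trans (cong (_+ Σ≤ m (λ b → f (suc n) b)) (Σ≤-swap n m f))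
        (sym (Σ≤-+ m (λ b → Σ≤ n (λ a → f a b)) (λ b → f (suc n) b)))

Σ≤-reverse : ∀ n (f : ℕ → ℕ) → Σ≤ n f ≡ Σ≤ n (λ j → f (n ∸ j))
Σ≤-reverse zero    f = refl
Σ≤-reverse (suc n) f =
  trans (cong (_+ f (suc n)) (Σ≤-reverse n f))
  (trans (+-comm (Σ≤ n (λ j → f (n ∸ j))) (f (suc n)))
         (sym (Σ≤-shift n (λ j → f (suc n ∸ j)))))

Σ≤-point : ∀ n c (f : ℕ → ℕ) → (∀ j → j ≢ c → f j ≡ 0) → c ≤ n → Σ≤ n f ≡ f c
Σ≤-point zero    .zero f h z≤n = refl
Σ≤-point (suc n) c     f h c≤ with c ≟ suc n
... | yes refl = cong (_+ f (suc n)) (Σ≤-zero n (λ j p → h j (<⇒≢ (s≤s p))))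
... | no c≢    = trans (cong₂ _+_ (Σ≤-point n c f h (≤-pred (≤∧≢⇒< c≤ c≢)))
                                  (h (suc n) (≢-sym c≢)))
                       (+-identityʳ (f c))

Σ≤-none : ∀ n c (f : ℕ → ℕ) → (∀ j → j ≢ c → f j ≡ 0) → n < c → Σ≤ n f ≡ 0
Σ≤-none n c f h n<c = Σ≤-zero n (λ j p → h j (<⇒≢ (≤-<-trans p n<c)))

Σ≤-extend : ∀ n m (f : ℕ → ℕ) → n ≤ m → (∀ j → n < j → f j ≡ 0) → Σ≤ m f ≡ Σ≤ n f
Σ≤-extend n m f n≤m h =
  trans (cong (λ x → Σ≤ x f) (sym (m+[n∸m]≡n n≤m))) (go (m ∸ n))
  where
  go : ∀ k → Σ≤ (n + k) f ≡ Σ≤ n f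
  go zero    = cong (λ x → Σ≤ x f) (+-identityʳ n)
  go (suc k) =
    trans (cong (λ x → Σ≤ x f) (+-suc n k))
    (trans (cong₂ _+_ (go k) (h (suc (n + k)) (s≤s (m≤m+n n k))))
           (+-identityʳ (Σ≤ n f)))

Σ≤-triangle : ∀ n (F : ℕ → ℕ → ℕ) →
  Σ≤ n (λ a → Σ≤ a (λ b → F a b)) ≡ Σ≤ n (λ b → Σ≤ (n ∸ b) (λ c → F (b + c) b))
Σ≤-triangle zero    F = refl
Σ≤-triangle (suc n) F =
  begin
    Σ≤ n (λ a → Σ≤ a (F a)) + Σ≤ (suc n) (F (suc n))
  ≡⟨ cong (_+ Σ≤ (suc n) (F (suc n))) (Σ≤-triangle n F) ⟩
    Σ≤ n (λ b → Σ≤ (n ∸ b) (row b)) + (Σ≤ n (F (suc n)) + F (suc n) (suc n))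
  ≡⟨ sym (+-assoc (Σ≤ n (λ b → Σ≤ (n ∸ b) (row b))) _ _) ⟩
    (Σ≤ n (λ b → Σ≤ (n ∸ b) (row b)) + Σ≤ n (F (suc n))) + F (suc n) (suc n)
  ≡⟨ cong₂ _+_ (trans (sym (Σ≤-+ n _ _)) (Σ≤-cong n extendRow))
               (cong (λ x → F x (suc n)) (sym (+-identityʳ (suc n)))) ⟩
    Σ≤ n (λ b → Σ≤ (suc n ∸ b) (row b)) + F (suc n + 0) (suc n)
  ≡⟨ cong (λ x → Σ≤ n (λ b → Σ≤ (suc n ∸ b) (row b)) + Σ≤ x (row (suc n))) (sym (n∸n≡0 n)) ⟩
    Σ≤ (suc n) (λ b → Σ≤ (suc n ∸ b) (row b))
  ∎
  where
  open ≡-Reasoning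
  row : ℕ → ℕ → ℕ
  row b c = F (b + c) b
  extendRow : ∀ b → b ≤ n → Σ≤ (n ∸ b) (row b) + F (suc n) b ≡ Σ≤ (suc n ∸ b) (row b)
  extendRow b b≤n =
    trans (cong (λ x → Σ≤ (n ∸ b) (row b) + F x b)
                (sym (trans (+-suc b (n ∸ b)) (cong suc (m+[n∸m]≡n b≤n)))))
          (cong (λ x → Σ≤ x (row b)) (sym (+-∸-assoc 1 b≤n)))

⊛-cong : ∀ {f f′ g g′} → f ≋ f′ → g ≋ g′ → (f ⊛ g) ≋ (f′ ⊛ g′)
⊛-cong p q n = Σ≤-cong′ n (λ j → cong₂ _*_ (p j) (q (n ∸ j)))

⊛-comm : ∀ f g → (f ⊛ g) ≋ (g ⊛ f)
⊛-comm f g n =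
  trans (Σ≤-reverse n (λ j → f j * g (n ∸ j)))
        (Σ≤-cong n (λ j j≤n → trans (cong (λ x → f (n ∸ j) * g x) (m∸[m∸n]≡n j≤n))
                                    (*-comm (f (n ∸ j)) (g j))))

⊛-distribʳ : ∀ f g h → ((g ⊕ h) ⊛ f) ≋ ((g ⊛ f) ⊕ (h ⊛ f))
⊛-distribʳ f g h n =
  trans (Σ≤-cong′ n (λ j → *-distribʳ-+ (f (n ∸ j)) (g j) (h j))) (Σ≤-+ n _ _)

⊛-identityˡ : ∀ f → (oneT ⊛ f) ≋ f
⊛-identityˡ f zero    = +-identityʳ (f 0)
⊛-identityˡ f (suc n) =
  trans (Σ≤-shift n (λ j → oneT j * f (suc n ∸ j)))
        (trans (cong₂ _+_ (+-identityʳ (f (suc n))) (Σ≤-zero n (λ j _ → refl)))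
               (+-identityʳ (f (suc n))))

⊛-zeroˡ : ∀ f → (0S ⊛ f) ≋ 0S
⊛-zeroˡ f n = Σ≤-zero n (λ j _ → refl)

⊛-assoc : ∀ f g h → ((f ⊛ g) ⊛ h) ≋ (f ⊛ (g ⊛ h))
⊛-assoc f g h n =
  begin
    Σ≤ n (λ a → Σ≤ a (λ b → f b * g (a ∸ b)) * h (n ∸ a))
  ≡⟨ Σ≤-cong′ n (λ a → Σ≤-*ʳ a (h (n ∸ a)) (λ b → f b * g (a ∸ b))) ⟩
    Σ≤ n (λ a → Σ≤ a (λ b → f b * g (a ∸ b) * h (n ∸ a)))
  ≡⟨ Σ≤-triangle n (λ a b → f b * g (a ∸ b) * h (n ∸ a)) ⟩
    Σ≤ n (λ b → Σ≤ (n ∸ b) (λ c → f b * g (b + c ∸ b) * h (n ∸ (b + c))))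
  ≡⟨ Σ≤-cong′ n (λ b → trans (Σ≤-cong′ (n ∸ b) (λ c →
        trans (*-assoc (f b) (g (b + c ∸ b)) (h (n ∸ (b + c))))
              (cong₂ (λ x y → f b * (g x * h y)) (m+n∸m≡n b c) (sym (∸-+-assoc n b c)))))
        (sym (Σ≤-*ˡ (n ∸ b) (f b) (λ c → g c * h (n ∸ b ∸ c))))) ⟩
    Σ≤ n (λ b → f b * Σ≤ (n ∸ b) (λ c → g c * h (n ∸ b ∸ c)))
  ∎
  where open ≡-Reasoning

seriesSemiring : CommutativeSemiring _ _
seriesSemiring = record
  { Carrier = Series
  ; _≈_ = _≋_
  ; _+_ = _⊕_
  ; _*_ = _⊛_
  ; 0# = 0S
  ; 1# = oneT
  ; isCommutativeSemiring = isCommutativeSemiringˡ record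
    { +-isCommutativeMonoid = record
      { isMonoid = record
        { isSemigroup = record
          { isMagma = record { isEquivalence = ≋-isEquivalence
                             ; ∙-cong = λ p q n → cong₂ _+_ (p n) (q n) }
          ; assoc = λ f g h n → +-assoc (f n) (g n) (h n) }
        ; identity = (λ f n → refl) , (λ f n → +-identityʳ (f n)) }
      ; comm = λ f g n → +-comm (f n) (g n) }
    ; *-isCommutativeMonoid = record
      { isMonoid = record
        { isSemigroup = record
          { isMagma = record { isEquivalence = ≋-isEquivalence ; ∙-cong = ⊛-cong }
          ; assoc = ⊛-assoc }
        ; identity = ⊛-identityˡ , (λ f → ≋-trans (⊛-comm f oneT) (⊛-identityˡ f)) }
      ; comm = ⊛-comm }
    ; distribʳ = ⊛-distribʳ
    ; zeroˡ = ⊛-zeroˡ }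
  }
  where
  ≋-isEquivalence : IsEquivalence _≋_
  ≋-isEquivalence = record { refl = ≋-refl ; sym = ≋-sym ; trans = ≋-trans }

open import Algebra.Solver.Ring.NaturalCoefficients.Default seriesSemiring
  using (solve; _:+_; _:*_; _:=_; con)
open SetoidReasoning (CommutativeSemiring.setoid seriesSemiring)

⊛-congʳ : ∀ f {g g′} → g ≋ g′ → (f ⊛ g) ≋ (f ⊛ g′)
⊛-congʳ f q = ⊛-cong {f = f} {f′ = f} ≋-refl q

⊛-congˡ : ∀ {f f′} g → f ≋ f′ → (f ⊛ g) ≋ (f′ ⊛ g)
⊛-congˡ g p = ⊛-cong {g = g} {g′ = g} p ≋-refl

⊕-cong : ∀ {f f′ g g′} → f ≋ f′ → g ≋ g′ → (f ⊕ g) ≋ (f′ ⊕ g′)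
⊕-cong p q n = cong₂ _+_ (p n) (q n)

⊕-congʳ : ∀ f {g g′} → g ≋ g′ → (f ⊕ g) ≋ (f ⊕ g′)
⊕-congʳ f q = ⊕-cong {f = f} {f′ = f} ≋-refl q

⊕-congˡ : ∀ {f f′} g → f ≋ f′ → (f ⊕ g) ≋ (f′ ⊕ g)
⊕-congˡ g p = ⊕-cong {g = g} {g′ = g} p ≋-refl

⊛-zeroʳ : ∀ f → (f ⊛ 0S) ≋ 0S
⊛-zeroʳ f = ≋-trans (⊛-comm f 0S) (⊛-zeroˡ f)

infix 30 q^_
q^_ : ℕ → Series
(q^ zero)  n       = oneT n
(q^ suc k) zero    = 0
(q^ suc k) (suc n) = (q^ k) n

q^-self : ∀ k → (q^ k) k ≡ 1
q^-self zero    = refl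
q^-self (suc k) = q^-self k

q^-other : ∀ k j → j ≢ k → (q^ k) j ≡ 0
q^-other zero    zero    ne = contradiction refl ne
q^-other zero    (suc j) ne = refl
q^-other (suc k) zero    ne = refl
q^-other (suc k) (suc j) ne = q^-other k j (λ e → ne (cong suc e))

q^-cong : ∀ {a b} → a ≡ b → q^ a ≋ q^ b
q^-cong refl n = refl

q^⊛-≥ : ∀ k X n → k ≤ n → (q^ k ⊛ X) n ≡ X (n ∸ k)
q^⊛-≥ k X n k≤n =
  trans (Σ≤-point n k (λ j → (q^ k) j * X (n ∸ j))
                  (λ j ne → cong (_* X (n ∸ j)) (q^-other k j ne)) k≤n)
        (trans (cong (_* X (n ∸ k)) (q^-self k)) (+-identityʳ (X (n ∸ k))))

q^⊛-< : ∀ k X n → n < k → (q^ k ⊛ X) n ≡ 0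
q^⊛-< k X n n<k = Σ≤-none n k (λ j → (q^ k) j * X (n ∸ j))
                    (λ j ne → cong (_* X (n ∸ j)) (q^-other k j ne)) n<k

q^0 : q^ 0 ≋ oneT
q^0 n = refl

q^-+ : ∀ a b → (q^ a ⊛ q^ b) ≋ q^ (a + b)
q^-+ zero    b = ⊛-identityˡ (q^ b)
q^-+ (suc a) b zero    = refl
q^-+ (suc a) b (suc n) =
  trans (Σ≤-shift n (λ j → (q^ suc a) j * (q^ b) (suc n ∸ j))) (q^-+ a b n)

q^⊛-agree : ∀ t X Y n → (∀ m → m + t ≤ n → X m ≡ Y m) → (q^ t ⊛ X) n ≡ (q^ t ⊛ Y) n
q^⊛-agree t X Y n agree with t ≤? n
... | yes t≤n = trans (q^⊛-≥ t X n t≤n)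
                 (trans (agree (n ∸ t) (≤-reflexive (m∸n+n≡m t≤n))) (sym (q^⊛-≥ t Y n t≤n)))
... | no t≰n  = trans (q^⊛-< t X n (≰⇒> t≰n)) (sym (q^⊛-< t Y n (≰⇒> t≰n)))

⊕-q^⊛-below : ∀ Y k Z n → n < k → (Y ⊕ q^ k ⊛ Z) n ≡ Y n
⊕-q^⊛-below Y k Z n n<k = trans (cong (Y n +_) (q^⊛-< k Z n n<k)) (+-identityʳ (Y n))

fixpoint-unique : ∀ k A X Y → X ≋ A ⊕ q^ suc k ⊛ X → Y ≋ A ⊕ q^ suc k ⊛ Y → X ≋ Y
fixpoint-unique k A X Y hX hY = <-rec (λ n → X n ≡ Y n) step
  where
  step : ∀ n → (∀ {m} → m < n → X m ≡ Y m) → X n ≡ Y n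
  step n ih = trans (hX n) (trans (cong (A n +_) (q^⊛-agree (suc k) X Y n below)) (sym (hY n)))
    where
    below : ∀ m → m + suc k ≤ n → X m ≡ Y m
    below m le = ih (<-≤-trans (m<m+n m (s≤s z≤n)) le)

infix 4 _≈[_]_
_≈[_]_ : Series → ℕ → Series → Set
f ≈[ N ] g = ∀ n → n ≤ N → f n ≡ g n

≋⇒≈ : ∀ {f g} N → f ≋ g → f ≈[ N ] g
≋⇒≈ N p n _ = p n

≈-refl : ∀ {f N} → f ≈[ N ] f
≈-refl n _ = refl

≈-sym : ∀ {f g N} → f ≈[ N ] g → g ≈[ N ] f
≈-sym p n le = sym (p n le)

≈-trans : ∀ {f g h N} → f ≈[ N ] g → g ≈[ N ] h → f ≈[ N ] h
≈-trans p q n le = trans (p n le) (q n le)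

≈-weaken : ∀ {f g N M} → M ≤ N → f ≈[ N ] g → f ≈[ M ] g
≈-weaken M≤N p n le = p n (≤-trans le M≤N)

⊛-cong≈ : ∀ {f f′ g g′ N} → f ≈[ N ] f′ → g ≈[ N ] g′ → (f ⊛ g) ≈[ N ] (f′ ⊛ g′)
⊛-cong≈ p q n n≤N =
  Σ≤-cong n (λ j j≤n → cong₂ _*_ (p j (≤-trans j≤n n≤N)) (q (n ∸ j) (≤-trans (m∸n≤m n j) n≤N)))

⊛-cancelʳ : ∀ A B C N → C 0 ≡ 1 → (A ⊛ C) ≈[ N ] (B ⊛ C) → A ≈[ N ] B
⊛-cancelʳ A B C N c0 h n = <-rec (λ n → n ≤ N → A n ≡ B n) step n
  where
  leading : ∀ F m → F m * C (m ∸ m) ≡ F m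
  leading F m = trans (cong (λ x → F m * C x) (n∸n≡0 m))
                      (trans (cong (F m *_) c0) (*-identityʳ (F m)))
  step : ∀ n → (∀ {m} → m < n → m ≤ N → A m ≡ B m) → n ≤ N → A n ≡ B n
  step zero    _  le = trans (sym (leading A 0)) (trans (h 0 le) (leading B 0))
  step (suc m) ih le =
    trans (sym (leading A (suc m)))
    (trans (+-cancelˡ-≡ (Σ≤ m (λ j → A j * C (suc m ∸ j))) _ _
             (trans (h (suc m) le) (cong (_+ B (suc m) * C (suc m ∸ suc m)) (sym lower))))
           (leading B (suc m)))
    where
    lower : Σ≤ m (λ j → A j * C (suc m ∸ j)) ≡ Σ≤ m (λ j → B j * C (suc m ∸ j))
    lower = Σ≤-cong m (λ j j≤m → cong (_* C (suc m ∸ j))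
                                      (ih (s≤s j≤m) (≤-trans (m≤n⇒m≤1+n j≤m) le)))

-- Geometric series  geom e = 1/(1 - q^e) = Σ_k q^(k e)   (e ≥ 1)

ind : Bool → ℕ
ind b = if b then 1 else 0

≡ᵇ-true : ∀ m n → m ≡ n → (m ≡ᵇ n) ≡ true
≡ᵇ-true m n = dec-true (m ≟ n)

≡ᵇ-false : ∀ m n → m ≢ n → (m ≡ᵇ n) ≡ false
≡ᵇ-false m n = dec-false (m ≟ n)

≡ᵇ-⇔ : ∀ a b c d → (a ≡ b → c ≡ d) → (c ≡ d → a ≡ b) → (a ≡ᵇ b) ≡ (c ≡ᵇ d)
≡ᵇ-⇔ a b c d to from = does-⇔ (mk⇔ to from) (a ≟ b) (c ≟ d)

geom : ℕ → Series
geom e n = Σ≤ n (λ k → ind (k * e ≡ᵇ n))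

geom-cong : ∀ {a b} → a ≡ b → geom a ≋ geom b
geom-cong refl n = refl

geom-unfold : ∀ e → geom (suc e) ≋ oneT ⊕ q^ suc e ⊛ geom (suc e)
geom-unfold e zero    = refl
geom-unfold e (suc m) with suc e ≤? suc m
... | yes E≤ =
  trans (Σ≤-shift m (λ k → ind (k * E ≡ᵇ suc m)))
  (trans (Σ≤-cong′ m (λ j → cong ind (≡ᵇ-⇔ (E + j * E) (suc m) (j * E) (suc m ∸ E)
            (λ p → trans (sym (m+n∸m≡n E (j * E))) (cong (_∸ E) p))
            (λ p → trans (cong (E +_) p) (m+[n∸m]≡n E≤)))))
  (trans (Σ≤-extend (suc m ∸ E) m (λ j → ind (j * E ≡ᵇ suc m ∸ E)) (m∸n≤m m e)
            (λ j lt → cong ind (≡ᵇ-false (j * E) (suc m ∸ E)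
                                  (λ p → <⇒≢ (<-≤-trans lt (m≤m*n j E)) (sym p)))))
         (sym (q^⊛-≥ E (geom E) (suc m) E≤))))
  where E = suc e
... | no E≰ =
  trans (Σ≤-shift m (λ k → ind (k * E ≡ᵇ suc m)))
  (trans (Σ≤-zero m (λ j _ → cong ind (≡ᵇ-false (E + j * E) (suc m)
            (λ p → <⇒≢ (<-≤-trans (≰⇒> E≰) (m≤m+n E (j * E))) (sym p)))))
         (sym (q^⊛-< E (geom E) (suc m) (≰⇒> E≰))))
  where E = suc e

geom≈1 : ∀ e N → N < suc e → geom (suc e) ≈[ N ] oneT
geom≈1 e N lt n le =
  trans (geom-unfold e n)
        (trans (cong (oneT n +_) (q^⊛-< (suc e) (geom (suc e)) n (≤-<-trans le lt))) (+-identityʳ (oneT n)))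

geom-split : ∀ k → geom (suc k) ≋ (oneT ⊕ q^ suc k) ⊛ geom (2 * suc k)
geom-split k = fixpoint-unique k oneT (geom (suc k)) Y (geom-unfold k) Y-unfold
  where
  x = q^ suc k
  g = geom (2 * suc k)
  Y = (oneT ⊕ x) ⊛ g
  x²=q^2k : (x ⊛ x) ≋ q^ (2 * suc k)
  x²=q^2k = ≋-trans (q^-+ (suc k) (suc k)) (q^-cong (cong (suc k +_) (sym (+-identityʳ (suc k)))))
  g-unfold : g ≋ oneT ⊕ (x ⊛ x) ⊛ g
  g-unfold = ≋-trans (geom-unfold (k + suc (k + 0))) (⊕-congʳ oneT (⊛-congˡ g (≋-sym x²=q^2k)))
  Y-unfold : Y ≋ oneT ⊕ x ⊛ Y
  Y-unfold = begin
    (oneT ⊕ x) ⊛ g                                ≈⟨ ⊛-congʳ (oneT ⊕ x) g-unfold ⟩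
    (oneT ⊕ x) ⊛ (oneT ⊕ (x ⊛ x) ⊛ g)
      ≈⟨ solve 2 (λ x g → (con 1 :+ x) :* (con 1 :+ (x :* x) :* g)
                         := con 1 :+ x :* ((con 1 :+ (x :* x) :* g) :+ x :* g)) ≋-refl x g ⟩
    oneT ⊕ x ⊛ ((oneT ⊕ (x ⊛ x) ⊛ g) ⊕ x ⊛ g)
      ≈⟨ ⊕-congʳ oneT (⊛-congʳ x (⊕-congˡ (x ⊛ g) (≋-sym g-unfold))) ⟩
    oneT ⊕ x ⊛ (g ⊕ x ⊛ g)
      ≈⟨ ⊕-congʳ oneT (⊛-congʳ x (solve 2 (λ x g → g :+ x :* g := (con 1 :+ x) :* g) ≋-refl x g)) ⟩
    oneT ⊕ x ⊛ Y ∎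

-- Right-hand side: the coefficients of t⁰, t¹, t² of
--   ∏_{i ≥ 1} 1/((1 - q^(2i-1))(1 - t q^(2i)))

infix 30 [t^_]_
[t^_]_ : ℕ → QTSeries → Series
([t^ r ] F) n = F n r

[t^]-⊠ : ∀ F G r → [t^ r ] (F ⊠ G) ≋ λ n → Σ≤ r (λ b → ([t^ b ] F ⊛ [t^ r ∸ b ] G) n)
[t^]-⊠ F G r n = Σ≤-swap n r (λ a b → F a b * G (n ∸ a) (r ∸ b))

[t^0]-geo : ∀ e → [t^ 0 ] geo e 0 ≋ geom e
[t^0]-geo e n = Σ≤-cong′ n (λ k → cong ind
  (trans (cong (λ x → (k * e ≡ᵇ n) ∧ (x ≡ᵇ 0)) (*-zeroʳ k)) (∧-identityʳ (k * e ≡ᵇ n))))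

[t^suc]-geo : ∀ e r → [t^ suc r ] geo e 0 ≋ 0S
[t^suc]-geo e r n = Σ≤-zero n (λ k _ → cong ind
  (trans (cong (λ x → (k * e ≡ᵇ n) ∧ (x ≡ᵇ suc r)) (*-zeroʳ k)) (∧-zeroʳ (k * e ≡ᵇ n))))

[t^]-geo-t : ∀ e r → [t^ r ] geo (suc e) 1 ≋ q^ (r * suc e)
[t^]-geo-t e r n with r ≤? n
... | yes r≤n =
  trans (Σ≤-point n r _ off r≤n)
  (trans (cong ind (trans (cong (λ x → (r * E ≡ᵇ n) ∧ (x ≡ᵇ r)) (*-identityʳ r))
                   (trans (cong ((r * E ≡ᵇ n) ∧_) (≡ᵇ-true r r refl)) (∧-identityʳ _))))
         (on (r * E ≟ n)))
  where
  E = suc e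
  off : ∀ k → k ≢ r → ind ((k * E ≡ᵇ n) ∧ (k * 1 ≡ᵇ r)) ≡ 0
  off k ne = cong ind (trans (cong (λ x → (k * E ≡ᵇ n) ∧ (x ≡ᵇ r)) (*-identityʳ k))
                       (trans (cong ((k * E ≡ᵇ n) ∧_) (≡ᵇ-false k r ne)) (∧-zeroʳ _)))
  on : Dec (r * E ≡ n) → ind (r * E ≡ᵇ n) ≡ (q^ (r * E)) n
  on (yes p) = trans (cong ind (≡ᵇ-true _ _ p)) (sym (trans (cong (q^ (r * E)) (sym p)) (q^-self (r * E))))
  on (no p)  = trans (cong ind (≡ᵇ-false _ _ p)) (sym (q^-other (r * E) n (≢-sym p)))
... | no r≰n =
  trans (Σ≤-none n r _ off (≰⇒> r≰n))
        (sym (q^-other (r * E) n (λ q → <⇒≢ (<-≤-trans (≰⇒> r≰n) (m≤m*n r E)) q)))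
  where
  E = suc e
  off : ∀ k → k ≢ r → ind ((k * E ≡ᵇ n) ∧ (k * 1 ≡ᵇ r)) ≡ 0
  off k ne = cong ind (trans (cong (λ x → (k * E ≡ᵇ n) ∧ (x ≡ᵇ r)) (*-identityʳ k))
                       (trans (cong ((k * E ≡ᵇ n) ∧_) (≡ᵇ-false k r ne)) (∧-zeroʳ _)))

[t^]-factor : ∀ a e s → [t^ s ] (geo a 0 ⊠ geo (suc e) 1) ≋ geom a ⊛ q^ (s * suc e)
[t^]-factor a e zero = ≋-trans ([t^]-⊠ (geo a 0) (geo (suc e) 1) 0)
                               (⊛-cong ([t^0]-geo a) ([t^]-geo-t e 0))
[t^]-factor a e (suc s) n =
  trans ([t^]-⊠ (geo a 0) (geo (suc e) 1) (suc s) n)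
  (trans (Σ≤-shift s (λ b → ([t^ b ] geo a 0 ⊛ [t^ suc s ∸ b ] geo (suc e) 1) n))
  (trans (cong₂ _+_ (⊛-cong ([t^0]-geo a) ([t^]-geo-t e (suc s)) n)
                    (Σ≤-zero s (λ b _ → trans (⊛-congˡ ([t^ s ∸ b ] geo (suc e) 1) ([t^suc]-geo a b) n)
                                              (⊛-zeroˡ ([t^ s ∸ b ] geo (suc e) 1) n))))
         (+-identityʳ _)))

invOddPoch : ℕ → Series
invOddPoch zero    = oneT
invOddPoch (suc j) = invOddPoch j ⊛ geom (suc (2 * j))

-- h₁ and h₂ of q², q⁴, …, q^(2j)
h₁ : ℕ → Series
h₁ zero    = 0S
h₁ (suc j) = h₁ j ⊕ q^ (2 * suc j)

h₂ : ℕ → Series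
h₂ zero    = 0S
h₂ (suc j) = h₂ j ⊕ h₁ j ⊛ q^ (2 * suc j) ⊕ q^ (2 * (2 * suc j))

rhsProd-step : ∀ j r → [t^ r ] rhsProd (suc j) ≋
  λ n → Σ≤ r (λ b → ([t^ b ] rhsProd j ⊛ (geom (suc (2 * j)) ⊛ q^ ((r ∸ b) * (2 * suc j)))) n)
rhsProd-step j r = ≋-trans ([t^]-⊠ (rhsProd j) (geo (suc (2 * j)) 0 ⊠ geo (2 * suc j) 1) r)
  (λ n → Σ≤-cong′ r (λ b → ⊛-congʳ ([t^ b ] rhsProd j) ([t^]-factor (suc (2 * j)) (j + suc (j + 0)) (r ∸ b)) n))

[t^suc]-oneQT : ∀ r → [t^ suc r ] oneQT ≋ 0S
[t^suc]-oneQT r zero    = refl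
[t^suc]-oneQT r (suc n) = refl

rhsProd-t⁰ : ∀ j → [t^ 0 ] rhsProd j ≋ invOddPoch j
rhsProd-t⁰ zero zero    = refl
rhsProd-t⁰ zero (suc n) = refl
rhsProd-t⁰ (suc j) = begin
  [t^ 0 ] rhsProd (suc j)                     ≈⟨ rhsProd-step j 0 ⟩
  [t^ 0 ] rhsProd j ⊛ (g ⊛ q^ 0)             ≈⟨ ⊛-cong (rhsProd-t⁰ j) (⊛-congʳ g q^0) ⟩
  invOddPoch j ⊛ (g ⊛ oneT)
    ≈⟨ solve 2 (λ o g → o :* (g :* con 1) := o :* g) ≋-refl (invOddPoch j) g ⟩
  invOddPoch j ⊛ g ∎
  where g = geom (suc (2 * j))

rhsProd-t¹ : ∀ j → [t^ 1 ] rhsProd j ≋ invOddPoch j ⊛ h₁ j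
rhsProd-t¹ zero = ≋-trans ([t^suc]-oneQT 0) (≋-sym (⊛-zeroʳ oneT))
rhsProd-t¹ (suc j) = begin
  [t^ 1 ] rhsProd (suc j)                     ≈⟨ rhsProd-step j 1 ⟩
  [t^ 0 ] rhsProd j ⊛ (g ⊛ q^ (1 * e)) ⊕ [t^ 1 ] rhsProd j ⊛ (g ⊛ q^ 0)
    ≈⟨ ⊕-cong (⊛-cong (rhsProd-t⁰ j) (⊛-congʳ g (q^-cong (*-identityˡ e))))
              (⊛-cong (rhsProd-t¹ j) (⊛-congʳ g q^0)) ⟩
  invOddPoch j ⊛ (g ⊛ q^ e) ⊕ (invOddPoch j ⊛ h₁ j) ⊛ (g ⊛ oneT)
    ≈⟨ solve 4 (λ o g h m → o :* (g :* m) :+ (o :* h) :* (g :* con 1) := (o :* g) :* (h :+ m))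
             ≋-refl (invOddPoch j) g (h₁ j) (q^ e) ⟩
  (invOddPoch j ⊛ g) ⊛ (h₁ j ⊕ q^ e) ∎
  where
  g = geom (suc (2 * j))
  e = 2 * suc j

rhsProd-t² : ∀ j → [t^ 2 ] rhsProd j ≋ invOddPoch j ⊛ h₂ j
rhsProd-t² zero = ≋-trans ([t^suc]-oneQT 1) (≋-sym (⊛-zeroʳ oneT))
rhsProd-t² (suc j) = begin
  [t^ 2 ] rhsProd (suc j)                     ≈⟨ rhsProd-step j 2 ⟩
  [t^ 0 ] rhsProd j ⊛ (g ⊛ q^ (2 * e)) ⊕ [t^ 1 ] rhsProd j ⊛ (g ⊛ q^ (1 * e)) ⊕ [t^ 2 ] rhsProd j ⊛ (g ⊛ q^ 0)
    ≈⟨ ⊕-cong (⊕-cong (⊛-congˡ (g ⊛ q^ (2 * e)) (rhsProd-t⁰ j))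
                      (⊛-cong (rhsProd-t¹ j) (⊛-congʳ g (q^-cong (*-identityˡ e)))))
              (⊛-cong (rhsProd-t² j) (⊛-congʳ g q^0)) ⟩
  invOddPoch j ⊛ (g ⊛ q^ (2 * e)) ⊕ (invOddPoch j ⊛ h₁ j) ⊛ (g ⊛ q^ e) ⊕ (invOddPoch j ⊛ h₂ j) ⊛ (g ⊛ oneT)
    ≈⟨ solve 6 (λ o g h1 h2 m mm → o :* (g :* mm) :+ (o :* h1) :* (g :* m) :+ (o :* h2) :* (g :* con 1)
                  := (o :* g) :* (h2 :+ h1 :* m :+ mm))
             ≋-refl (invOddPoch j) g (h₁ j) (h₂ j) (q^ e) (q^ (2 * e)) ⟩
  (invOddPoch j ⊛ g) ⊛ (h₂ j ⊕ h₁ j ⊛ q^ e ⊕ q^ (2 * e)) ∎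
  where
  g = geom (suc (2 * j))
  e = 2 * suc j

-- the full h₁ and h₂ of q², q⁴, q⁶, …
h₁∞ : Series
h₁∞ = q^ 2 ⊛ geom 2

h₂∞ : Series
h₂∞ = q^ 4 ⊛ (geom 2 ⊛ geom 4)

h₁∞-split : ∀ j → h₁∞ ≋ h₁ j ⊕ q^ (2 * suc j) ⊛ geom 2
h₁∞-split zero n = refl
h₁∞-split (suc j) = begin
  h₁∞                                           ≈⟨ h₁∞-split j ⟩
  h₁ j ⊕ q^ e ⊛ geom 2                         ≈⟨ ⊕-congʳ (h₁ j) (⊛-congʳ (q^ e) (geom-unfold 1)) ⟩
  h₁ j ⊕ q^ e ⊛ (oneT ⊕ q^ 2 ⊛ geom 2)
    ≈⟨ solve 4 (λ h m m2 g → h :+ m :* (con 1 :+ m2 :* g) := (h :+ m) :+ (m :* m2) :* g)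
         ≋-refl (h₁ j) (q^ e) (q^ 2) (geom 2) ⟩
  (h₁ j ⊕ q^ e) ⊕ (q^ e ⊛ q^ 2) ⊛ geom 2
    ≈⟨ ⊕-congʳ (h₁ j ⊕ q^ e) (⊛-congˡ (geom 2) (≋-trans (q^-+ e 2) (q^-cong (e+2 j)))) ⟩
  (h₁ j ⊕ q^ e) ⊕ q^ (2 * suc (suc j)) ⊛ geom 2 ∎
  where
  e = 2 * suc j
  e+2 : ∀ j → 2 * suc j + 2 ≡ 2 * suc (suc j)
  e+2 = solve-∀

geom2⊛geom4-unfold : geom 2 ⊛ geom 4 ≋ (oneT ⊕ q^ 2 ⊛ geom 2) ⊕ q^ 4 ⊛ (geom 2 ⊛ geom 4)
geom2⊛geom4-unfold = begin
  geom 2 ⊛ geom 4                               ≈⟨ ⊛-congʳ (geom 2) (geom-unfold 3) ⟩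
  geom 2 ⊛ (oneT ⊕ q^ 4 ⊛ geom 4)
    ≈⟨ solve 3 (λ a b m → a :* (con 1 :+ m :* b) := a :+ m :* (a :* b)) ≋-refl (geom 2) (geom 4) (q^ 4) ⟩
  geom 2 ⊕ q^ 4 ⊛ (geom 2 ⊛ geom 4)            ≈⟨ ⊕-congˡ (q^ 4 ⊛ (geom 2 ⊛ geom 4)) (geom-unfold 1) ⟩
  (oneT ⊕ q^ 2 ⊛ geom 2) ⊕ q^ 4 ⊛ (geom 2 ⊛ geom 4) ∎

h₂∞-split : ∀ j → h₂∞ ≋ h₂ j ⊕ h₁ j ⊛ (q^ (2 * suc j) ⊛ geom 2) ⊕ q^ (4 * j) ⊛ h₂∞
h₂∞-split zero n =
  sym (trans (cong₂ _+_ (⊛-zeroˡ (q^ 2 ⊛ geom 2) n) (⊛-identityˡ h₂∞ n)) refl)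
h₂∞-split (suc j) = begin
  h₂∞                                          ≈⟨ h₂∞-split j ⟩
  h₂ j ⊕ h₁ j ⊛ (m ⊛ g) ⊕ q^ (4 * j) ⊛ (q^ 4 ⊛ gg)
    ≈⟨ ⊕-congʳ (h₂ j ⊕ h₁ j ⊛ (m ⊛ g))
         (≋-trans (≋-sym (⊛-assoc (q^ (4 * j)) (q^ 4) gg)) (⊛-congˡ gg q^4j⊛q^4)) ⟩
  h₂ j ⊕ h₁ j ⊛ (m ⊛ g) ⊕ (m ⊛ m) ⊛ gg
    ≈⟨ ⊕-cong (⊕-congʳ (h₂ j) (⊛-congʳ (h₁ j) (⊛-congʳ m (geom-unfold 1))))
              (⊛-congʳ (m ⊛ m) geom2⊛geom4-unfold) ⟩
  h₂ j ⊕ h₁ j ⊛ (m ⊛ (oneT ⊕ q^ 2 ⊛ g)) ⊕ (m ⊛ m) ⊛ ((oneT ⊕ q^ 2 ⊛ g) ⊕ q^ 4 ⊛ gg)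
    ≈⟨ solve 7 (λ h1 h2 m m2 m4 g gg →
          h2 :+ h1 :* (m :* (con 1 :+ m2 :* g)) :+ (m :* m) :* ((con 1 :+ m2 :* g) :+ m4 :* gg)
          := (h2 :+ h1 :* m :+ m :* m) :+ (h1 :+ m) :* ((m :* m2) :* g) :+ (m :* m) :* (m4 :* gg))
        ≋-refl (h₁ j) (h₂ j) m (q^ 2) (q^ 4) g gg ⟩
  (h₂ j ⊕ h₁ j ⊛ m ⊕ m ⊛ m) ⊕ (h₁ j ⊕ m) ⊛ ((m ⊛ q^ 2) ⊛ g) ⊕ (m ⊛ m) ⊛ h₂∞
    ≈⟨ ⊕-cong (⊕-cong (⊕-congʳ (h₂ j ⊕ h₁ j ⊛ m) (≋-trans (q^-+ e e) (q^-cong (e+e≡2e j))))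
                      (⊛-congʳ (h₁ j ⊕ m) (⊛-congˡ g (≋-trans (q^-+ e 2) (q^-cong (e+2 j))))))
              (⊛-congˡ h₂∞ (≋-trans (q^-+ e e) (q^-cong (e+e≡4j+4 j)))) ⟩
  (h₂ j ⊕ h₁ j ⊛ m ⊕ q^ (2 * e)) ⊕ (h₁ j ⊕ m) ⊛ (q^ (2 * suc (suc j)) ⊛ g) ⊕ q^ (4 * suc j) ⊛ h₂∞ ∎
  where
  e = 2 * suc j
  m = q^ e
  g = geom 2
  gg = geom 2 ⊛ geom 4
  e+2 : ∀ j → 2 * suc j + 2 ≡ 2 * suc (suc j)
  e+2 = solve-∀
  e+e≡2e : ∀ j → 2 * suc j + 2 * suc j ≡ 2 * (2 * suc j)
  e+e≡2e = solve-∀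
  e+e≡4j+4 : ∀ j → 2 * suc j + 2 * suc j ≡ 4 * suc j
  e+e≡4j+4 = solve-∀
  q^4j⊛q^4 : q^ (4 * j) ⊛ q^ 4 ≋ m ⊛ m
  q^4j⊛q^4 = ≋-trans (q^-+ (4 * j) 4)
               (≋-trans (q^-cong (trans (4j+4 j) (sym (e+e≡4j+4 j)))) (≋-sym (q^-+ e e)))
    where
    4j+4 : ∀ j → 4 * j + 4 ≡ 4 * suc j
    4j+4 = solve-∀

n<2n+2 : ∀ n → n < 2 * suc n
n<2n+2 n = s≤s (m≤m+n n (1 * suc n))

-- [q^n] of the right-hand side only sees the first n factors, so the
-- truncated h₁, h₂ may be replaced by h₁∞, h₂∞.
rhs-t⁰ : ∀ n → rhsCoeff n 0 ≡ invOddPoch n n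
rhs-t⁰ n = rhsProd-t⁰ n n

rhs-t¹ : ∀ n → rhsCoeff n 1 ≡ (invOddPoch n ⊛ h₁∞) n
rhs-t¹ n = trans (rhsProd-t¹ n n)
  (sym (trans (split n) (⊕-q^⊛-below (O ⊛ h₁ n) (2 * suc n) (O ⊛ geom 2) n (n<2n+2 n))))
  where
  O = invOddPoch n
  split : O ⊛ h₁∞ ≋ O ⊛ h₁ n ⊕ q^ (2 * suc n) ⊛ (O ⊛ geom 2)
  split = begin
    O ⊛ h₁∞                                    ≈⟨ ⊛-congʳ O (h₁∞-split n) ⟩
    O ⊛ (h₁ n ⊕ q^ (2 * suc n) ⊛ geom 2)
      ≈⟨ solve 4 (λ o h m g → o :* (h :+ m :* g) := o :* h :+ m :* (o :* g)) ≋-refl O (h₁ n) (q^ (2 * suc n)) (geom 2) ⟩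
    O ⊛ h₁ n ⊕ q^ (2 * suc n) ⊛ (O ⊛ geom 2) ∎

rhs-t² : ∀ n → rhsCoeff n 2 ≡ (invOddPoch n ⊛ h₂∞) n
rhs-t² n = trans (rhsProd-t² n n)
  (sym (trans (split n)
       (trans (⊕-q^⊛-below (O ⊛ h₂ n ⊕ q^ e ⊛ (O ⊛ (h₁ n ⊛ geom 2))) (4 * n + 4) (O ⊛ gg) n n<4n+4)
              (⊕-q^⊛-below (O ⊛ h₂ n) e (O ⊛ (h₁ n ⊛ geom 2)) n (n<2n+2 n)))))
  where
  O = invOddPoch n
  e = 2 * suc n
  gg = geom 2 ⊛ geom 4
  n<4n+4 : n < 4 * n + 4
  n<4n+4 = ≤-<-trans (m≤m+n n (3 * n)) (m<m+n (4 * n) (s≤s z≤n))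
  split : O ⊛ h₂∞ ≋ O ⊛ h₂ n ⊕ q^ e ⊛ (O ⊛ (h₁ n ⊛ geom 2)) ⊕ q^ (4 * n + 4) ⊛ (O ⊛ gg)
  split = begin
    O ⊛ h₂∞                                    ≈⟨ ⊛-congʳ O (h₂∞-split n) ⟩
    O ⊛ (h₂ n ⊕ h₁ n ⊛ (q^ e ⊛ geom 2) ⊕ q^ (4 * n) ⊛ (q^ 4 ⊛ gg))
      ≈⟨ solve 8 (λ o h2 h1 m M m4 w g → o :* (h2 :+ h1 :* (m :* g) :+ M :* (m4 :* w))
                    := o :* h2 :+ m :* (o :* (h1 :* g)) :+ (M :* m4) :* (o :* w))
           ≋-refl O (h₂ n) (h₁ n) (q^ e) (q^ (4 * n)) (q^ 4) gg (geom 2) ⟩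
    O ⊛ h₂ n ⊕ q^ e ⊛ (O ⊛ (h₁ n ⊛ geom 2)) ⊕ (q^ (4 * n) ⊛ q^ 4) ⊛ (O ⊛ gg)
      ≈⟨ ⊕-congʳ (O ⊛ h₂ n ⊕ q^ e ⊛ (O ⊛ (h₁ n ⊛ geom 2))) (⊛-congˡ (O ⊛ gg) (q^-+ (4 * n) 4)) ⟩
    O ⊛ h₂ n ⊕ q^ e ⊛ (O ⊛ (h₁ n ⊛ geom 2)) ⊕ q^ (4 * n + 4) ⊛ (O ⊛ gg) ∎

-- Euler's identity  Σ_m q^(m(m+1)/2)/(q)_m = (-q;q)_∞ = 1/(q;q²)_∞

invPoch : ℕ → Series
invPoch zero    = oneT
invPoch (suc k) = invPoch k ⊛ geom (suc k)

negPoch : ℕ → Series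
negPoch zero    = oneT
negPoch (suc k) = negPoch k ⊛ (oneT ⊕ q^ suc k)

invEvenPoch : ℕ → Series
invEvenPoch zero    = oneT
invEvenPoch (suc k) = invEvenPoch k ⊛ geom (2 * suc k)

invPoch-cong : ∀ {a b} → a ≡ b → invPoch a ≋ invPoch b
invPoch-cong refl n = refl

invEvenPoch-cong : ∀ {a b} → a ≡ b → invEvenPoch a ≋ invEvenPoch b
invEvenPoch-cong refl n = refl

invEvenPoch-0 : ∀ k → invEvenPoch k 0 ≡ 1
invEvenPoch-0 zero    = refl
invEvenPoch-0 (suc k) = trans (*-identityʳ (invEvenPoch k 0)) (invEvenPoch-0 k)

invPoch=neg⊛even : ∀ k → invPoch k ≋ negPoch k ⊛ invEvenPoch k
invPoch=neg⊛even zero n = sym (⊛-identityˡ oneT n)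
invPoch=neg⊛even (suc k) = begin
  invPoch k ⊛ geom (suc k)                    ≈⟨ ⊛-cong (invPoch=neg⊛even k) (geom-split k) ⟩
  (negPoch k ⊛ invEvenPoch k) ⊛ ((oneT ⊕ q^ suc k) ⊛ geom (2 * suc k))
    ≈⟨ solve 4 (λ d e a g → (d :* e) :* (a :* g) := (d :* a) :* (e :* g))
         ≋-refl (negPoch k) (invEvenPoch k) (oneT ⊕ q^ suc k) (geom (2 * suc k)) ⟩
  (negPoch k ⊛ (oneT ⊕ q^ suc k)) ⊛ (invEvenPoch k ⊛ geom (2 * suc k)) ∎

invPoch=odd⊛even : ∀ j → invPoch (2 * j) ≋ invOddPoch j ⊛ invEvenPoch j
invPoch=odd⊛even zero n = sym (⊛-identityˡ oneT n)
invPoch=odd⊛even (suc j) = begin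
  invPoch (2 * suc j)                          ≈⟨ invPoch-cong (*-suc 2 j) ⟩
  (invPoch (2 * j) ⊛ geom (suc (2 * j))) ⊛ geom (suc (suc (2 * j)))
    ≈⟨ ⊛-cong (⊛-congˡ (geom (suc (2 * j))) (invPoch=odd⊛even j)) (geom-cong (sym (*-suc 2 j))) ⟩
  ((invOddPoch j ⊛ invEvenPoch j) ⊛ geom (suc (2 * j))) ⊛ geom (2 * suc j)
    ≈⟨ solve 4 (λ o e a b → ((o :* e) :* a) :* b := (o :* a) :* (e :* b))
         ≋-refl (invOddPoch j) (invEvenPoch j) (geom (suc (2 * j))) (geom (2 * suc j)) ⟩
  (invOddPoch j ⊛ geom (suc (2 * j))) ⊛ (invEvenPoch j ⊛ geom (2 * suc j)) ∎

invEvenPoch-stable : ∀ j t → invEvenPoch (j + t) ≈[ suc (2 * j) ] invEvenPoch j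
invEvenPoch-stable j zero = ≋⇒≈ _ (invEvenPoch-cong (+-identityʳ j))
invEvenPoch-stable j (suc t) =
  ≈-trans (≋⇒≈ _ (invEvenPoch-cong (+-suc j t)))
  (≈-trans (⊛-cong≈ (invEvenPoch-stable j t) (geom≈1 ((j + t) + suc ((j + t) + 0)) (suc (2 * j)) lt))
           (≋⇒≈ _ (≋-trans (⊛-comm (invEvenPoch j) oneT) (⊛-identityˡ (invEvenPoch j)))))
  where
  lt : suc (2 * j) < suc ((j + t) + suc ((j + t) + 0))
  lt = s≤s (subst (suc (2 * j) ≤_) (sym (+-suc (j + t) ((j + t) + 0)))
             (s≤s (+-mono-≤ (m≤m+n j t) (+-monoˡ-≤ 0 (m≤m+n j t)))))

negPoch≈invOddPoch : ∀ n → negPoch (2 * n) ≈[ suc (2 * n) ] invOddPoch n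
negPoch≈invOddPoch n = ⊛-cancelʳ (negPoch (2 * n)) (invOddPoch n) (invEvenPoch n) _ (invEvenPoch-0 n)
  (≈-trans (⊛-cong≈ (≈-refl {negPoch (2 * n)}) (≈-sym (invEvenPoch-stable n (n + 0))))
           (≋⇒≈ _ (≋-trans (≋-sym (invPoch=neg⊛even (2 * n))) (invPoch=odd⊛even n))))

-- Sums Σ_m F_m of series with F_m ≡ 0 modulo q^m

Σ∞ : (ℕ → Series) → Series
Σ∞ F n = Σ≤ n (λ m → F m n)

Convergent : (ℕ → Series) → Set
Convergent F = ∀ m n → n < m → F m n ≡ 0

Σ∞-cong : ∀ {F G} → (∀ m → F m ≋ G m) → Σ∞ F ≋ Σ∞ G
Σ∞-cong h n = Σ≤-cong′ n (λ m → h m n)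

Σ∞-⊕ : ∀ F G → Σ∞ (λ m → F m ⊕ G m) ≋ Σ∞ F ⊕ Σ∞ G
Σ∞-⊕ F G n = Σ≤-+ n (λ m → F m n) (λ m → G m n)

Σ∞-⊛ : ∀ g F → Convergent F → g ⊛ Σ∞ F ≋ Σ∞ (λ m → g ⊛ F m)
Σ∞-⊛ g F conv n =
  trans (Σ≤-cong n (λ j j≤n → trans (cong (g j *_) (sym (Σ≤-extend (n ∸ j) n (λ m → F m (n ∸ j))
                                                       (m∸n≤m n j) (λ m lt → conv m (n ∸ j) lt))))
                                     (Σ≤-*ˡ n (g j) (λ m → F m (n ∸ j)))))
        (Σ≤-swap n n (λ j m → g j * F m (n ∸ j)))

Σ∞-tail : ∀ F → Convergent F → F 0 ≋ 0S → Σ∞ F ≋ Σ∞ (λ m → F (suc m))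
Σ∞-tail F conv z zero = trans (z 0) (sym (conv 1 0 (s≤s z≤n)))
Σ∞-tail F conv z (suc k) =
  trans (Σ≤-shift k (λ m → F m (suc k)))
  (trans (cong (_+ Σ≤ k (λ m → F (suc m) (suc k))) (z (suc k)))
         (sym (trans (cong (Σ≤ k (λ m → F (suc m) (suc k)) +_) (conv (suc (suc k)) (suc k) ≤-refl))
                     (+-identityʳ _))))

convergent-q^ : ∀ (e : ℕ → ℕ) (X : ℕ → Series) → (∀ m → m ≤ e m) → Convergent (λ m → q^ e m ⊛ X m)
convergent-q^ e X h m n lt = q^⊛-< (e m) (X m) n (<-≤-trans lt (h m))

triangle : ℕ → ℕ
triangle zero    = zero
triangle (suc m) = triangle m + suc m

triangle-≥ : ∀ m → m ≤ triangle m
triangle-≥ zero    = z≤n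
triangle-≥ (suc m) = m≤n+m (suc m) (triangle m)

eulerTerm : ℕ → ℕ → Series
eulerTerm k m = q^ (triangle m + k * m) ⊛ invPoch m

euler : ℕ → Series
euler k = Σ∞ (eulerTerm k)

convergent-eulerTerm : ∀ k → Convergent (eulerTerm k)
convergent-eulerTerm k =
  convergent-q^ (λ m → triangle m + k * m) invPoch (λ m → ≤-trans (triangle-≥ m) (m≤m+n _ _))

invPoch-unfold : ∀ m → invPoch (suc m) ≋ invPoch m ⊕ q^ suc m ⊛ invPoch (suc m)
invPoch-unfold m = begin
  invPoch m ⊛ geom (suc m)                     ≈⟨ ⊛-congʳ (invPoch m) (geom-unfold m) ⟩
  invPoch m ⊛ (oneT ⊕ q^ suc m ⊛ geom (suc m))
    ≈⟨ solve 3 (λ z a g → z :* (con 1 :+ a :* g) := z :+ a :* (z :* g)) ≋-refl (invPoch m) (q^ suc m) (geom (suc m)) ⟩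
  invPoch m ⊕ q^ suc m ⊛ (invPoch m ⊛ geom (suc m)) ∎

eulerTerm-unfold : ∀ k m → eulerTerm k (suc m) ≋ eulerTerm (suc k) (suc m) ⊕ q^ suc k ⊛ eulerTerm (suc k) m
eulerTerm-unfold k m = begin
  q^ e ⊛ invPoch (suc m)                       ≈⟨ ⊛-congʳ (q^ e) (invPoch-unfold m) ⟩
  q^ e ⊛ (invPoch m ⊕ q^ suc m ⊛ invPoch (suc m))
    ≈⟨ solve 4 (λ a z b z′ → a :* (z :+ b :* z′) := (a :* b) :* z′ :+ a :* z) ≋-refl (q^ e) (invPoch m) (q^ suc m) (invPoch (suc m)) ⟩
  (q^ e ⊛ q^ suc m) ⊛ invPoch (suc m) ⊕ q^ e ⊛ invPoch m
    ≈⟨ ⊕-cong (⊛-congˡ (invPoch (suc m)) (≋-trans (q^-+ e (suc m)) (q^-cong (exp-high (triangle m) m k))))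
              (⊛-congˡ (invPoch m) (≋-trans (q^-cong (exp-low (triangle m) m k)) (≋-sym (q^-+ (suc k) (triangle m + suc k * m))))) ⟩
  q^ (triangle (suc m) + suc k * suc m) ⊛ invPoch (suc m) ⊕ (q^ suc k ⊛ q^ (triangle m + suc k * m)) ⊛ invPoch m
    ≈⟨ ⊕-congʳ (eulerTerm (suc k) (suc m)) (⊛-assoc (q^ suc k) (q^ (triangle m + suc k * m)) (invPoch m)) ⟩
  eulerTerm (suc k) (suc m) ⊕ q^ suc k ⊛ eulerTerm (suc k) m ∎
  where
  e = triangle (suc m) + k * suc m
  exp-high : ∀ t m k → (t + suc m) + k * suc m + suc m ≡ (t + suc m) + suc k * suc m
  exp-high = solve-∀
  exp-low : ∀ t m k → (t + suc m) + k * suc m ≡ suc k + (t + suc k * m)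
  exp-low = solve-∀

euler-rec : ∀ k → euler k ≋ (oneT ⊕ q^ suc k) ⊛ euler (suc k)
euler-rec k = begin
  Σ∞ (eulerTerm k)                             ≈⟨ Σ∞-cong split ⟩
  Σ∞ (λ m → eulerTerm (suc k) m ⊕ B m)         ≈⟨ Σ∞-⊕ (eulerTerm (suc k)) B ⟩
  euler (suc k) ⊕ Σ∞ B                         ≈⟨ ⊕-congʳ (euler (suc k)) (Σ∞-tail B convB (λ _ → refl)) ⟩
  euler (suc k) ⊕ Σ∞ (λ m → q^ suc k ⊛ eulerTerm (suc k) m)
    ≈⟨ ⊕-congʳ (euler (suc k)) (≋-sym (Σ∞-⊛ (q^ suc k) (eulerTerm (suc k)) (convergent-eulerTerm (suc k)))) ⟩
  euler (suc k) ⊕ q^ suc k ⊛ euler (suc k)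
    ≈⟨ solve 2 (λ e a → e :+ a :* e := (con 1 :+ a) :* e) ≋-refl (euler (suc k)) (q^ suc k) ⟩
  (oneT ⊕ q^ suc k) ⊛ euler (suc k) ∎
  where
  B : ℕ → Series
  B zero    = 0S
  B (suc m) = q^ suc k ⊛ eulerTerm (suc k) m
  split : ∀ m → eulerTerm k m ≋ eulerTerm (suc k) m ⊕ B m
  split zero n    = trans (⊛-congˡ oneT (q^-cong (trans (*-zeroʳ k) (sym (*-zeroʳ (suc k))))) n) (sym (+-identityʳ _))
  split (suc m) = eulerTerm-unfold k m
  convB : Convergent B
  convB zero    n ()
  convB (suc m) n lt with suc k ≤? n
  ... | yes p = trans (q^⊛-≥ (suc k) (eulerTerm (suc k) m) n p) (convergent-eulerTerm (suc k) m (n ∸ suc k)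
                  (<-≤-trans (∸-monoʳ-< {n} {suc k} {0} (s≤s z≤n) p) (≤-pred lt)))
  ... | no p  = q^⊛-< (suc k) (eulerTerm (suc k) m) n (≰⇒> p)

euler0=negPoch⊛euler : ∀ k → euler 0 ≋ negPoch k ⊛ euler k
euler0=negPoch⊛euler zero n = sym (⊛-identityˡ (euler 0) n)
euler0=negPoch⊛euler (suc k) = begin
  euler 0                                      ≈⟨ euler0=negPoch⊛euler k ⟩
  negPoch k ⊛ euler k                           ≈⟨ ⊛-congʳ (negPoch k) (euler-rec k) ⟩
  negPoch k ⊛ ((oneT ⊕ q^ suc k) ⊛ euler (suc k))
    ≈⟨ ≋-sym (⊛-assoc (negPoch k) (oneT ⊕ q^ suc k) (euler (suc k))) ⟩
  (negPoch k ⊛ (oneT ⊕ q^ suc k)) ⊛ euler (suc k) ∎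

eulerTerm-0 : ∀ k → eulerTerm k 0 ≋ oneT
eulerTerm-0 k = ≋-trans (⊛-congˡ oneT (q^-cong (*-zeroʳ k))) (⊛-identityˡ oneT)

euler≈1 : ∀ k → euler k ≈[ k ] oneT
euler≈1 k zero le = eulerTerm-0 k 0
euler≈1 k (suc n) le =
  trans (Σ≤-shift n (λ m → eulerTerm k m (suc n)))
  (trans (cong₂ _+_ (eulerTerm-0 k (suc n))
                    (Σ≤-zero n (λ m _ → q^⊛-< (triangle (suc m) + k * suc m) (invPoch (suc m)) (suc n) (lt m))))
         (+-identityʳ 0))
  where
  lt : ∀ m → suc n < triangle (suc m) + k * suc m
  lt m = ≤-trans (s≤s le) (+-mono-≤ {1} {triangle (suc m)} (≤-trans (s≤s z≤n) (triangle-≥ (suc m))) (m≤m*n k (suc m)))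

euler≈invOddPoch : ∀ n → euler 0 ≈[ n ] invOddPoch n
euler≈invOddPoch n = ≈-weaken (m≤m+n n (n + 0)) (≈-trans E₀=D⊛E E₀≈D)
  where
  N = 2 * n
  D = negPoch N
  E₀=D⊛E : euler 0 ≈[ N ] D ⊛ euler N
  E₀=D⊛E = ≋⇒≈ N (euler0=negPoch⊛euler N)
  E₀≈D : D ⊛ euler N ≈[ N ] invOddPoch n
  E₀≈D = ≈-trans (⊛-cong≈ (≈-refl {D}) (euler≈1 N))
         (≈-trans (≋⇒≈ N (≋-trans (⊛-comm D oneT) (⊛-identityˡ D)))
                  (≈-weaken (n≤1+n N) (negPoch≈invOddPoch n)))

-- The coefficients of t⁰, t¹, t² of a Gaussian binomial [a+b choose b]_t

[_<_] : ℕ → ℕ → ℕ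
[ _     < zero  ] = 0
[ zero  < suc _ ] = 1
[ suc y < suc x ] = [ y < x ]

[<]-irrefl : ∀ k → [ k < k ] ≡ 0
[<]-irrefl zero    = refl
[<]-irrefl (suc k) = [<]-irrefl k

[<]-yes : ∀ y x → y < x → [ y < x ] ≡ 1
[<]-yes zero    (suc x) _       = refl
[<]-yes (suc y) (suc x) (s≤s p) = [<]-yes y x p

[<]-∸ : ∀ c y x → y ≤ x → [ c < x ∸ y ] ≡ [ c + y < x ]
[<]-∸ c zero    x       _       = cong (λ z → [ z < x ]) (sym (+-identityʳ c))
[<]-∸ c (suc y) (suc x) (s≤s p) = trans ([<]-∸ c y x p) (cong (λ z → [ z < suc x ]) (sym (+-suc c y)))

[<]-step : ∀ y k → [ y < k ] ≡ [ y < suc k ] * [ y < k ]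
[<]-step y       zero    = sym (*-zeroʳ [ y < 1 ])
[<]-step zero    (suc k) = refl
[<]-step (suc y) (suc k) = [<]-step y k

gauss-k0 : ∀ n → gauss n 0 ≡ oneT
gauss-k0 zero    = refl
gauss-k0 (suc n) = refl

gauss-t⁰ : ∀ b d → gauss (b + d) b 0 ≡ 1
gauss-t⁰ zero    d = cong (λ f → f 0) (gauss-k0 d)
gauss-t⁰ (suc b) d = trans (+-identityʳ _) (gauss-t⁰ b d)

gauss-t¹-suc : ∀ b d → gauss (suc (suc b + d)) (suc b) 1 ≡ 1
gauss-t¹-suc zero    d = gauss-t⁰ 1 d
gauss-t¹-suc (suc b) d = trans (+-identityʳ _) (gauss-t¹-suc b d)

gauss-t¹ : ∀ b d → gauss (suc (b + d)) b 1 ≡ [ 0 < b ]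
gauss-t¹ zero    d = refl
gauss-t¹ (suc b) d = gauss-t¹-suc b d

gauss-t²-b1 : ∀ d → gauss (suc (1 + d)) 1 2 ≡ [ 0 < d ]
gauss-t²-b1 zero    = refl
gauss-t²-b1 (suc d) = gauss-t¹-suc 0 d

gauss-t² : ∀ b d → gauss (suc (b + d)) b 2 ≡ [ 0 < b ] * [ 0 < d ] + [ 1 < b ]
gauss-t² zero                d = refl
gauss-t² (suc zero)          d = trans (gauss-t²-b1 d) (sym (trans (+-identityʳ ([ 0 < d ] + 0)) (+-identityʳ [ 0 < d ])))
gauss-t² (suc (suc zero))    d = trans (cong₂ _+_ (gauss-t²-b1 d) (gauss-t⁰ 2 d)) (cong (_+ 1) (sym (+-identityʳ [ 0 < d ])))
gauss-t² (suc (suc (suc c))) d = trans (+-identityʳ _) (gauss-t² (suc (suc c)) d)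

-- The factor [p - y + 1 choose x - y]_t attached to three consecutive parts
-- p ≥ x ≥ y of a partition: [t⁰] = 1, [t¹] = [y < x],
-- [t²] = [y < x][x < p] + [y + 1 < x].
factor-shape : ∀ y x p → y ≤ x → x ≤ p → p ∸ y + 1 ≡ suc ((x ∸ y) + (p ∸ x))
factor-shape y x p y≤x x≤p = trans (+-comm (p ∸ y) 1) (cong suc split)
  where
  split : p ∸ y ≡ (x ∸ y) + (p ∸ x)
  split = trans (cong (_∸ y) (sym (trans (cong ((p ∸ x) +_) (m∸n+n≡m y≤x)) (m∸n+n≡m x≤p))))
          (trans (cong (_∸ y) (sym (+-assoc (p ∸ x) (x ∸ y) y)))
          (trans (m+n∸n≡m ((p ∸ x) + (x ∸ y)) y) (+-comm (p ∸ x) (x ∸ y))))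

factor : ℕ → ℕ → ℕ → TSeries
factor y x p = gauss (p ∸ y + 1) (x ∸ y)

factor-reshape : ∀ y x p → y ≤ x → x ≤ p → factor y x p ≡ gauss (suc ((x ∸ y) + (p ∸ x))) (x ∸ y)
factor-reshape y x p y≤x x≤p = cong (λ a → gauss a (x ∸ y)) (factor-shape y x p y≤x x≤p)

factor-t⁰ : ∀ y x p → y ≤ x → x ≤ p → factor y x p 0 ≡ 1
factor-t⁰ y x p y≤x x≤p =
  trans (cong (λ f → f 0) (factor-reshape y x p y≤x x≤p))
  (trans (cong (λ a → gauss a (x ∸ y) 0) (sym (+-suc (x ∸ y) (p ∸ x)))) (gauss-t⁰ (x ∸ y) (suc (p ∸ x))))

factor-t¹ : ∀ y x p → y ≤ x → x ≤ p → factor y x p 1 ≡ [ y < x ]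
factor-t¹ y x p y≤x x≤p =
  trans (cong (λ f → f 1) (factor-reshape y x p y≤x x≤p))
        (trans (gauss-t¹ (x ∸ y) (p ∸ x)) ([<]-∸ 0 y x y≤x))

factor-t² : ∀ y x p → y ≤ x → x ≤ p → factor y x p 2 ≡ [ y < x ] * [ x < p ] + [ suc y < x ]
factor-t² y x p y≤x x≤p =
  trans (cong (λ f → f 2) (factor-reshape y x p y≤x x≤p))
  (trans (gauss-t² (x ∸ y) (p ∸ x))
         (cong₂ _+_ (cong₂ _*_ ([<]-∸ 0 y x y≤x) ([<]-∸ 0 x p x≤p)) ([<]-∸ 1 y x y≤x)))

hd : List ℕ → ℕ
hd τ = part τ 0

-- gaussProd p τ : the product of the factors of the partition p ∷ τ
gaussProd : ℕ → List ℕ → TSeries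
gaussProd p []       = oneT
gaussProd p (x ∷ xs) = factor (hd xs) x p ⊛ gaussProd x xs

-- prodGauss multiplies the factors from the smallest index up; peel off the first
prodUpTo-cons : ∀ p τ m → prodUpTo (p ∷ τ) (suc m) ≋ gaussFactor (p ∷ τ) 0 ⊛ prodUpTo τ m
prodUpTo-cons p τ zero    = ⊛-comm oneT (gaussFactor (p ∷ τ) 0)
prodUpTo-cons p τ (suc m) = ≋-trans (⊛-congˡ (gaussFactor τ m) (prodUpTo-cons p τ m))
                                    (⊛-assoc (gaussFactor (p ∷ τ) 0) (prodUpTo τ m) (gaussFactor τ m))

prodGauss=gaussProd : ∀ p τ → prodGauss (p ∷ τ) ≋ gaussProd p τ
prodGauss=gaussProd p []       = ≋-trans (⊛-identityˡ _) (λ n → cong (λ f → f n) (gauss-k0 (p ∸ 0 + 1)))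
prodGauss=gaussProd p (x ∷ xs) = ≋-trans (prodUpTo-cons p (x ∷ xs) (length (x ∷ xs)))
                                         (⊛-congʳ (factor (hd xs) x p) (prodGauss=gaussProd x xs))

monomial : ℕ → ℕ → Series
monomial d v n = if d ≡ᵇ n then v else 0

monomial-+ : ∀ t s v → monomial (t + s) v ≋ q^ t ⊛ monomial s v
monomial-+ t s v n with t ≤? n
... | yes t≤n =
  trans (cong (λ b → if b then v else 0)
              (≡ᵇ-⇔ (t + s) n s (n ∸ t) (λ e → trans (sym (m+n∸m≡n t s)) (cong (_∸ t) e))
                                        (λ e → trans (cong (t +_) e) (m+[n∸m]≡n t≤n))))
        (sym (q^⊛-≥ t (monomial s v) n t≤n))
... | no t≰n =
  trans (cong (λ b → if b then v else 0)
              (≡ᵇ-false (t + s) n (λ e → <⇒≢ (<-≤-trans (≰⇒> t≰n) (m≤m+n t s)) (sym e))))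
        (sym (q^⊛-< t (monomial s v) n (≰⇒> t≰n)))

monomial-⊕ : ∀ d a b → monomial d (a + b) ≋ monomial d a ⊕ monomial d b
monomial-⊕ d a b n with d ≡ᵇ n
... | true  = refl
... | false = refl

monomial-0 : ∀ d → monomial d 0 ≋ 0S
monomial-0 d n with d ≡ᵇ n
... | true  = refl
... | false = refl

sumOver : List (List ℕ) → (List ℕ → Series) → Series
sumOver []      h = 0S
sumOver (τ ∷ L) h = h τ ⊕ sumOver L h

sumOver-++ : ∀ L L′ h → sumOver (L ++ L′) h ≋ sumOver L h ⊕ sumOver L′ h
sumOver-++ []      L′ h n = refl
sumOver-++ (τ ∷ L) L′ h n = trans (cong (h τ n +_) (sumOver-++ L L′ h n)) (sym (+-assoc (h τ n) _ _))

sumOver-map : ∀ (g : List ℕ → List ℕ) L h → sumOver (map g L) h ≋ sumOver L (λ τ → h (g τ))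
sumOver-map g []      h n = refl
sumOver-map g (τ ∷ L) h n = cong (h (g τ) n +_) (sumOver-map g L h n)

sumOver-cong : ∀ L {h h′ : List ℕ → Series} → (∀ τ → h τ ≋ h′ τ) → sumOver L h ≋ sumOver L h′
sumOver-cong []      p n = refl
sumOver-cong (τ ∷ L) p n = cong₂ _+_ (p τ n) (sumOver-cong L p n)

sumOver-q^⊛ : ∀ L c h → sumOver L (λ τ → q^ c ⊛ h τ) ≋ q^ c ⊛ sumOver L h
sumOver-q^⊛ []      c h = ≋-sym (⊛-zeroʳ (q^ c))
sumOver-q^⊛ (τ ∷ L) c h =
  ≋-trans (⊕-congʳ (q^ c ⊛ h τ) (sumOver-q^⊛ L c h))
          (solve 3 (λ x a b → x :* a :+ x :* b := x :* (a :+ b)) ≋-refl (q^ c) (h τ) (sumOver L h))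

sumOver-⊕ : ∀ L h h′ → sumOver L (λ τ → h τ ⊕ h′ τ) ≋ sumOver L h ⊕ sumOver L h′
sumOver-⊕ []      h h′ n = refl
sumOver-⊕ (τ ∷ L) h h′ =
  ≋-trans (⊕-congʳ (h τ ⊕ h′ τ) (sumOver-⊕ L h h′))
          (solve 4 (λ a b c d → (a :+ b) :+ (c :+ d) := (a :+ c) :+ (b :+ d)) ≋-refl (h τ) (h′ τ) (sumOver L h) (sumOver L h′))

sumOver-0S : ∀ L → sumOver L (λ _ → 0S) ≋ 0S
sumOver-0S []      n = refl
sumOver-0S (τ ∷ L) n = sumOver-0S L n

sumOver-decLists : ∀ f k h → sumOver (decLists (suc f) (suc k)) h ≋
  sumOver (decLists (suc f) k) h ⊕ sumOver (decLists f (suc k)) (λ τ → h (suc k ∷ τ))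
sumOver-decLists f k h = begin
  sumOver ([] ∷ concatMap g (range1 k ++ suc k ∷ [])) h
    ≈⟨ (λ n → cong (λ L → sumOver ([] ∷ L) h n) (concatMap-++ g (range1 k) (suc k ∷ []))) ⟩
  h [] ⊕ sumOver (A ++ (g (suc k) ++ [])) h
    ≈⟨ ⊕-congʳ (h []) (≋-trans (sumOver-++ A (g (suc k) ++ []) h)
                               (⊕-congʳ (sumOver A h) (sumOver-++ (g (suc k)) [] h))) ⟩
  h [] ⊕ (sumOver A h ⊕ (sumOver (g (suc k)) h ⊕ 0S))
    ≈⟨ solve 3 (λ a b c → a :+ (b :+ (c :+ con 0)) := (a :+ b) :+ c) ≋-refl (h []) (sumOver A h) (sumOver (g (suc k)) h) ⟩
  sumOver (decLists (suc f) k) h ⊕ sumOver (g (suc k)) h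
    ≈⟨ ⊕-congʳ (sumOver (decLists (suc f) k) h) (sumOver-map (suc k ∷_) (decLists f (suc k)) h) ⟩
  sumOver (decLists (suc f) k) h ⊕ sumOver (decLists f (suc k)) (λ τ → h (suc k ∷ τ)) ∎
  where
  g : ℕ → List (List ℕ)
  g j = map (j ∷_) (decLists f j)
  A = concatMap g (range1 k)

weighted : (List ℕ → ℕ) → List ℕ → Series
weighted F τ = monomial (size τ) (F τ)

partSum : ℕ → ℕ → (List ℕ → ℕ) → Series
partSum f k F = sumOver (decLists f k) (weighted F)

partSum-empty : ∀ f F → partSum f 0 F ≋ weighted F [] ⊕ 0S
partSum-empty zero    F n = refl
partSum-empty (suc f) F n = refl

-- split according to whether the largest part is k+1
partSum-step : ∀ f k F → partSum (suc f) (suc k) F ≋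
  partSum (suc f) k F ⊕ q^ suc k ⊛ partSum f (suc k) (λ τ → F (suc k ∷ τ))
partSum-step f k F = ≋-trans (sumOver-decLists f k (weighted F))
  (⊕-congʳ (partSum (suc f) k F)
    (≋-trans (sumOver-cong (decLists f (suc k)) (λ τ → monomial-+ (suc k) (size τ) (F (suc k ∷ τ))))
             (sumOver-q^⊛ (decLists f (suc k)) (suc k) (weighted (λ τ → F (suc k ∷ τ))))))

-- a partition of n has at most n parts, so the bound f ≥ n is irrelevant
partSum-fuel : ∀ f k F n → n ≤ f → partSum (suc f) k F n ≡ partSum f k F n
partSum-fuel f zero F n _ = trans (partSum-empty (suc f) F n) (sym (partSum-empty f F n))
partSum-fuel zero (suc k) F zero z≤n =
  trans (partSum-step 0 k F 0)
        (trans (⊕-q^⊛-below (partSum 1 k F) (suc k) (partSum 0 (suc k) (λ τ → F (suc k ∷ τ))) 0 (s≤s z≤n)) (partSum-fuel zero k F zero z≤n))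
partSum-fuel (suc f) (suc k) F n n≤f =
  trans (partSum-step (suc f) k F n)
  (trans (cong₂ _+_ (partSum-fuel (suc f) k F n n≤f)
                    (q^⊛-agree (suc k) _ _ n (λ m le → partSum-fuel f (suc k) (λ τ → F (suc k ∷ τ)) m (m≤f m le))))
         (sym (partSum-step f k F n)))
  where
  m≤f : ∀ m → m + suc k ≤ n → m ≤ f
  m≤f m le = ≤-trans (m≤m+n m k) (≤-pred (subst (_≤ suc f) (+-suc m k) (≤-trans le n≤f)))

partGF : ℕ → (List ℕ → ℕ) → Series
partGF k F n = partSum n k F n

partSum-stable : ∀ f k F n → n ≤ f → partSum f k F n ≡ partGF k F n
partSum-stable f k F n n≤f = trans (cong (λ x → partSum x k F n) (sym (m+[n∸m]≡n n≤f))) (go (f ∸ n))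
  where
  go : ∀ t → partSum (n + t) k F n ≡ partSum n k F n
  go zero    = cong (λ x → partSum x k F n) (+-identityʳ n)
  go (suc t) = trans (cong (λ x → partSum x k F n) (+-suc n t))
                     (trans (partSum-fuel (n + t) k F n (m≤m+n n t)) (go t))

partGF-empty : ∀ F → partGF 0 F ≋ weighted F []
partGF-empty F n = trans (partSum-empty n F n) (+-identityʳ _)

partGF-step : ∀ k F → partGF (suc k) F ≋ partGF k F ⊕ q^ suc k ⊛ partGF (suc k) (λ τ → F (suc k ∷ τ))
partGF-step k F zero = sym (⊕-q^⊛-below (partGF k F) (suc k) (partGF (suc k) (λ τ → F (suc k ∷ τ))) 0 (s≤s z≤n))
partGF-step k F (suc n) =
  trans (partSum-step n k F (suc n))
        (cong (partGF k F (suc n) +_)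
              (q^⊛-agree (suc k) _ _ (suc n) (λ m le → partSum-stable n (suc k) (λ τ → F (suc k ∷ τ)) m (m≤n m le))))
  where
  m≤n : ∀ m → m + suc k ≤ suc n → m ≤ n
  m≤n m le = ≤-trans (m≤m+n m k) (≤-pred (subst (_≤ suc n) (+-suc m k) le))

partSum-cong : ∀ f k F G → (∀ τ → hd τ ≤ k → F τ ≡ G τ) → partSum f k F ≋ partSum f k G
partSum-cong f zero F G h =
  ≋-trans (partSum-empty f F) (≋-trans (⊕-congˡ 0S (λ n → cong (λ v → monomial 0 v n) (h [] z≤n)))
                                       (≋-sym (partSum-empty f G)))
partSum-cong zero (suc k) F G h n = cong (λ v → monomial 0 v n + 0) (h [] z≤n)
partSum-cong (suc f) (suc k) F G h =
  ≋-trans (partSum-step f k F)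
  (≋-trans (⊕-cong (partSum-cong (suc f) k F G (λ τ le → h τ (m≤n⇒m≤1+n le)))
                   (⊛-congʳ (q^ suc k) (partSum-cong f (suc k) (λ τ → F (suc k ∷ τ)) (λ τ → G (suc k ∷ τ))
                                                       (λ τ _ → h (suc k ∷ τ) ≤-refl))))
           (≋-sym (partSum-step f k G)))

partGF-cong : ∀ k F G → (∀ τ → hd τ ≤ k → F τ ≡ G τ) → partGF k F ≋ partGF k G
partGF-cong k F G h n = partSum-cong n k F G h n

partGF-⊕ : ∀ k F G → partGF k (λ τ → F τ + G τ) ≋ partGF k F ⊕ partGF k G
partGF-⊕ k F G n = trans (sumOver-cong (decLists n k) (λ τ → monomial-⊕ (size τ) (F τ) (G τ)) n)
                        (sumOver-⊕ (decLists n k) (weighted F) (weighted G) n)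

partGF-zero : ∀ k → partGF k (λ _ → 0) ≋ 0S
partGF-zero k n = trans (sumOver-cong (decLists n k) (λ τ → monomial-0 (size τ)) n) (sumOver-0S (decLists n k) n)

partGF-below : ∀ k G → partGF (suc k) (λ τ → [ hd τ < suc k ] * G τ) ≋ partGF k G
partGF-below k G = ≋-trans (partGF-step k H)
  (≋-trans (⊕-cong (partGF-cong k H G (λ τ le → trans (cong (_* G τ) ([<]-yes (hd τ) (suc k) (s≤s le))) (+-identityʳ (G τ))))
                   (≋-trans (⊛-congʳ (q^ suc k)
                              (≋-trans (partGF-cong (suc k) _ (λ _ → 0) (λ τ _ → cong (_* G (suc k ∷ τ)) ([<]-irrefl k)))
                                       (partGF-zero (suc k))))
                            (⊛-zeroʳ (q^ suc k))))
           (λ n → +-identityʳ _))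
  where
  H : List ℕ → ℕ
  H τ = [ hd τ < suc k ] * G τ

-- Closed forms for the partition sums A_r(p, k), r = 0, 1, 2

invPochPred : ℕ → Series
invPochPred zero    = 0S
invPochPred (suc j) = invPoch j

closed₁ : ℕ → Series
closed₁ zero    = 0S
closed₁ (suc k) = (q^ 1 ⊛ geom 1) ⊛ invPoch k

closed₂ : ℕ → Series
closed₂ zero          = 0S
closed₂ (suc zero)    = 0S
closed₂ (suc (suc j)) = ((q^ 1 ⊛ geom 1) ⊛ geom 2) ⊛ invPoch j

-- the value of A_2(p, k) when p > k
closed₂⁺ : ℕ → Series
closed₂⁺ k = closed₂ k ⊕ q^ k ⊛ invPochPred k

q^-suc : ∀ j → q^ suc j ≋ q^ j ⊛ q^ 1
q^-suc j = ≋-trans (q^-cong (+-comm 1 j)) (≋-sym (q^-+ j 1))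

geom1⊛geom2-unfold : geom 1 ⊛ geom 2 ≋ (oneT ⊕ q^ 1) ⊕ (q^ 1 ⊛ q^ 1) ⊛ geom 1 ⊕ (q^ 1 ⊛ q^ 1) ⊛ (geom 1 ⊛ geom 2)
geom1⊛geom2-unfold = begin
  g1 ⊛ g2                                     ≈⟨ ⊛-congʳ g1 g2-unfold ⟩
  g1 ⊛ (oneT ⊕ (x ⊛ x) ⊛ g2)
    ≈⟨ solve 3 (λ a b y → a :* (con 1 :+ (y :* y) :* b) := a :+ (y :* y) :* (a :* b)) ≋-refl g1 g2 x ⟩
  g1 ⊕ (x ⊛ x) ⊛ (g1 ⊛ g2)                    ≈⟨ ⊕-congˡ ((x ⊛ x) ⊛ (g1 ⊛ g2)) (geom-unfold 0) ⟩
  (oneT ⊕ x ⊛ g1) ⊕ (x ⊛ x) ⊛ (g1 ⊛ g2)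
    ≈⟨ ⊕-congˡ ((x ⊛ x) ⊛ (g1 ⊛ g2)) (⊕-congʳ oneT (⊛-congʳ x (geom-unfold 0))) ⟩
  (oneT ⊕ x ⊛ (oneT ⊕ x ⊛ g1)) ⊕ (x ⊛ x) ⊛ (g1 ⊛ g2)
    ≈⟨ solve 3 (λ a w y → (con 1 :+ y :* (con 1 :+ y :* a)) :+ w := (con 1 :+ y) :+ (y :* y) :* a :+ w) ≋-refl g1 ((x ⊛ x) ⊛ (g1 ⊛ g2)) x ⟩
  (oneT ⊕ x) ⊕ (x ⊛ x) ⊛ g1 ⊕ (x ⊛ x) ⊛ (g1 ⊛ g2) ∎
  where
  x = q^ 1
  g1 = geom 1
  g2 = geom 2
  g2-unfold : g2 ≋ oneT ⊕ (x ⊛ x) ⊛ g2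
  g2-unfold = ≋-trans (geom-unfold 1) (⊕-congʳ oneT (⊛-congˡ g2 (≋-sym (q^-+ 1 1))))

-- the fixed-point equations satisfied by closed₁ and closed₂ (cf. A₁-step, A₂-step)
closed₁-unfold : ∀ k → closed₁ (suc k) ≋ (closed₁ k ⊕ q^ suc k ⊛ invPoch k) ⊕ q^ suc k ⊛ closed₁ (suc k)
closed₁-unfold zero = begin
  (x ⊛ g1) ⊛ oneT                              ≈⟨ ⊛-congˡ oneT (⊛-congʳ x (geom-unfold 0)) ⟩
  (x ⊛ (oneT ⊕ x ⊛ g1)) ⊛ oneT
    ≈⟨ solve 2 (λ y a → (y :* (con 1 :+ y :* a)) :* con 1 := (con 0 :+ y :* con 1) :+ y :* ((y :* a) :* con 1)) ≋-refl x g1 ⟩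
  (0S ⊕ x ⊛ oneT) ⊕ x ⊛ ((x ⊛ g1) ⊛ oneT) ∎
  where
  x = q^ 1
  g1 = geom 1
closed₁-unfold (suc j) = begin
  (x ⊛ g1) ⊛ Z′                                ≈⟨ ⊛-congʳ (x ⊛ g1) (invPoch-unfold j) ⟩
  (x ⊛ g1) ⊛ (invPoch j ⊕ v ⊛ Z′)
    ≈⟨ solve 5 (λ y a z z′ w → (y :* a) :* (z :+ w :* z′) := (y :* a) :* z :+ (w :* y) :* (a :* z′)) ≋-refl x g1 (invPoch j) Z′ v ⟩
  (x ⊛ g1) ⊛ invPoch j ⊕ (v ⊛ x) ⊛ (g1 ⊛ Z′)
    ≈⟨ ⊕-congʳ ((x ⊛ g1) ⊛ invPoch j) (⊛-congʳ (v ⊛ x) (⊛-congˡ Z′ (geom-unfold 0))) ⟩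
  (x ⊛ g1) ⊛ invPoch j ⊕ (v ⊛ x) ⊛ ((oneT ⊕ x ⊛ g1) ⊛ Z′)
    ≈⟨ solve 5 (λ y a z z′ u → (y :* a) :* z :+ u :* ((con 1 :+ y :* a) :* z′) := ((y :* a) :* z :+ u :* z′) :+ u :* ((y :* a) :* z′))
         ≋-refl x g1 (invPoch j) Z′ (v ⊛ x) ⟩
  ((x ⊛ g1) ⊛ invPoch j ⊕ (v ⊛ x) ⊛ Z′) ⊕ (v ⊛ x) ⊛ ((x ⊛ g1) ⊛ Z′)
    ≈⟨ ⊕-cong (⊕-congʳ ((x ⊛ g1) ⊛ invPoch j) (⊛-congˡ Z′ (≋-sym (q^-suc (suc j)))))
              (⊛-congˡ ((x ⊛ g1) ⊛ Z′) (≋-sym (q^-suc (suc j)))) ⟩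
  ((x ⊛ g1) ⊛ invPoch j ⊕ q^ suc (suc j) ⊛ Z′) ⊕ q^ suc (suc j) ⊛ ((x ⊛ g1) ⊛ Z′) ∎
  where
  x = q^ 1
  g1 = geom 1
  v = q^ suc j
  Z′ = invPoch (suc j)

closed₂-unfold : ∀ k → closed₂ (suc k) ≋ (closed₂⁺ k ⊕ q^ suc k ⊛ (closed₁ k ⊕ invPochPred k)) ⊕ q^ suc k ⊛ closed₂ (suc k)
closed₂-unfold zero = solve 2 (λ y m0 → con 0 := ((con 0 :+ m0 :* con 0) :+ y :* (con 0 :+ con 0)) :+ y :* con 0) ≋-refl (q^ 1) (q^ 0)
closed₂-unfold (suc zero) = begin
  ((x ⊛ g1) ⊛ g2) ⊛ oneT
    ≈⟨ solve 3 (λ y a b → ((y :* a) :* b) :* con 1 := y :* (a :* b)) ≋-refl x g1 g2 ⟩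
  x ⊛ (g1 ⊛ g2)                                ≈⟨ ⊛-congʳ x geom1⊛geom2-unfold ⟩
  x ⊛ ((oneT ⊕ x) ⊕ (x ⊛ x) ⊛ g1 ⊕ (x ⊛ x) ⊛ (g1 ⊛ g2))
    ≈⟨ solve 3 (λ y a b → y :* ((con 1 :+ y) :+ (y :* y) :* a :+ (y :* y) :* (a :* b))
                 := ((con 0 :+ y :* con 1) :+ (y :* y) :* ((y :* a) :* con 1 :+ con 1)) :+ (y :* y) :* (((y :* a) :* b) :* con 1))
        ≋-refl x g1 g2 ⟩
  ((0S ⊕ x ⊛ oneT) ⊕ (x ⊛ x) ⊛ ((x ⊛ g1) ⊛ oneT ⊕ oneT)) ⊕ (x ⊛ x) ⊛ (((x ⊛ g1) ⊛ g2) ⊛ oneT)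
    ≈⟨ ⊕-cong (⊕-congʳ (0S ⊕ x ⊛ oneT) (⊛-congˡ ((x ⊛ g1) ⊛ oneT ⊕ oneT) (q^-+ 1 1)))
              (⊛-congˡ (((x ⊛ g1) ⊛ g2) ⊛ oneT) (q^-+ 1 1)) ⟩
  ((0S ⊕ x ⊛ oneT) ⊕ q^ 2 ⊛ ((x ⊛ g1) ⊛ oneT ⊕ oneT)) ⊕ q^ 2 ⊛ (((x ⊛ g1) ⊛ g2) ⊛ oneT) ∎
  where
  x = q^ 1
  g1 = geom 1
  g2 = geom 2
closed₂-unfold (suc (suc j)) = begin
  ((x ⊛ g1) ⊛ g2) ⊛ Z′                         ≈⟨ ⊛-congʳ ((x ⊛ g1) ⊛ g2) (invPoch-unfold j) ⟩
  ((x ⊛ g1) ⊛ g2) ⊛ (invPoch j ⊕ v ⊛ Z′)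
    ≈⟨ solve 6 (λ y a b z z′ w → ((y :* a) :* b) :* (z :+ w :* z′) := ((y :* a) :* b) :* z :+ (w :* y) :* ((a :* b) :* z′))
         ≋-refl x g1 g2 (invPoch j) Z′ v ⟩
  ((x ⊛ g1) ⊛ g2) ⊛ invPoch j ⊕ (v ⊛ x) ⊛ ((g1 ⊛ g2) ⊛ Z′)
    ≈⟨ ⊕-congʳ (((x ⊛ g1) ⊛ g2) ⊛ invPoch j) (⊛-congʳ (v ⊛ x) (⊛-congˡ Z′ geom1⊛geom2-unfold)) ⟩
  ((x ⊛ g1) ⊛ g2) ⊛ invPoch j ⊕ (v ⊛ x) ⊛ (((oneT ⊕ x) ⊕ (x ⊛ x) ⊛ g1 ⊕ (x ⊛ x) ⊛ (g1 ⊛ g2)) ⊛ Z′)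
    ≈⟨ solve 6 (λ y a b z z′ w → ((y :* a) :* b) :* z :+ (w :* y) :* (((con 1 :+ y) :+ (y :* y) :* a :+ (y :* y) :* (a :* b)) :* z′)
                 := (((y :* a) :* b) :* z :+ (w :* y) :* z′) :+ ((w :* y) :* y) :* ((y :* a) :* z′ :+ z′) :+ ((w :* y) :* y) :* (((y :* a) :* b) :* z′))
        ≋-refl x g1 g2 (invPoch j) Z′ v ⟩
  (((x ⊛ g1) ⊛ g2) ⊛ invPoch j ⊕ (v ⊛ x) ⊛ Z′) ⊕ ((v ⊛ x) ⊛ x) ⊛ ((x ⊛ g1) ⊛ Z′ ⊕ Z′) ⊕ ((v ⊛ x) ⊛ x) ⊛ (((x ⊛ g1) ⊛ g2) ⊛ Z′)
    ≈⟨ ⊕-cong (⊕-cong (⊕-congʳ (((x ⊛ g1) ⊛ g2) ⊛ invPoch j) (⊛-congˡ Z′ (≋-sym v⊛x)))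
                      (⊛-congˡ ((x ⊛ g1) ⊛ Z′ ⊕ Z′) (≋-sym v⊛x⊛x)))
              (⊛-congˡ (((x ⊛ g1) ⊛ g2) ⊛ Z′) (≋-sym v⊛x⊛x)) ⟩
  (((x ⊛ g1) ⊛ g2) ⊛ invPoch j ⊕ q^ suc (suc j) ⊛ Z′) ⊕ q^ suc (suc (suc j)) ⊛ ((x ⊛ g1) ⊛ Z′ ⊕ Z′)
    ⊕ q^ suc (suc (suc j)) ⊛ (((x ⊛ g1) ⊛ g2) ⊛ Z′) ∎
  where
  x = q^ 1
  g1 = geom 1
  g2 = geom 2
  v = q^ suc j
  Z′ = invPoch (suc j)
  v⊛x : q^ suc (suc j) ≋ v ⊛ x
  v⊛x = q^-suc (suc j)
  v⊛x⊛x : q^ suc (suc (suc j)) ≋ (v ⊛ x) ⊛ x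
  v⊛x⊛x = ≋-trans (q^-suc (suc (suc j))) (⊛-congˡ x v⊛x)

-- A_r(p, k) = Σ_τ [t^r] gaussProd p τ · q^|τ| over partitions τ with parts ≤ k:
-- the contribution of the parts below a part p
A : ℕ → ℕ → ℕ → Series
A r p k = partGF k (λ τ → gaussProd p τ r)

-- Removing the largest part k+1 of τ (with k+1 ≤ p) multiplies by the
-- factor [p - hd τ + 1 choose k+1 - hd τ]_t; its coefficients give:
gaussProd-t⁰ : ∀ p k τ → hd τ ≤ suc k → suc k ≤ p → gaussProd p (suc k ∷ τ) 0 ≡ gaussProd (suc k) τ 0
gaussProd-t⁰ p k τ le pk = trans (cong (_* gaussProd (suc k) τ 0) (factor-t⁰ (hd τ) (suc k) p le pk)) (+-identityʳ _)

gaussProd-t¹ : ∀ p k τ → hd τ ≤ suc k → suc k ≤ p →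
  gaussProd p (suc k ∷ τ) 1 ≡ gaussProd (suc k) τ 1 + [ hd τ < suc k ] * gaussProd (suc k) τ 0
gaussProd-t¹ p k τ le pk =
  cong₂ _+_ (trans (cong (_* gaussProd (suc k) τ 1) (factor-t⁰ (hd τ) (suc k) p le pk)) (+-identityʳ _))
            (cong (_* gaussProd (suc k) τ 0) (factor-t¹ (hd τ) (suc k) p le pk))

gaussProd-t² : ∀ p k τ → hd τ ≤ suc k → suc k ≤ p →
  let P = gaussProd (suc k) τ ; a = [ hd τ < suc k ] in
  gaussProd p (suc k ∷ τ) 2 ≡ P 2 + a * P 1 + a * ([ suc k < p ] * P 0) + [ hd τ < k ] * P 0
gaussProd-t² p k τ le pk =
  trans (cong₂ (λ u v → u * P 2 + v * P 1 + factor (hd τ) (suc k) p 2 * P 0)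
               (factor-t⁰ (hd τ) (suc k) p le pk) (factor-t¹ (hd τ) (suc k) p le pk))
  (trans (cong (λ c → 1 * P 2 + a * P 1 + c * P 0) (factor-t² (hd τ) (suc k) p le pk))
         (expand (P 2) (P 1) (P 0) a [ suc k < p ] [ hd τ < k ]))
  where
  P = gaussProd (suc k) τ
  a = [ hd τ < suc k ]
  expand : ∀ p2 p1 p0 a c b → 1 * p2 + a * p1 + (a * c + b) * p0 ≡ p2 + a * p1 + a * (c * p0) + b * p0
  expand = solve-∀

regroup : ∀ a m b c → a ⊕ m ⊛ (b ⊕ c) ≋ (a ⊕ m ⊛ c) ⊕ m ⊛ b
regroup = solve 4 (λ a m b c → a :+ m :* (b :+ c) := (a :+ m :* c) :+ m :* b) ≋-refl

A₀-step : ∀ k p → suc k ≤ p → A 0 p (suc k) ≋ A 0 p k ⊕ q^ suc k ⊛ A 0 (suc k) (suc k)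
A₀-step k p pk = ≋-trans (partGF-step k (λ τ → gaussProd p τ 0))
  (⊕-congʳ (A 0 p k) (⊛-congʳ (q^ suc k) (partGF-cong (suc k) _ _ (λ τ le → gaussProd-t⁰ p k τ le pk))))

A₀ : ∀ k p → k ≤ p → A 0 p k ≋ invPoch k
A₀ zero p _ = ≋-trans (partGF-empty _) empty
  where
  empty : weighted (λ τ → gaussProd p τ 0) [] ≋ oneT
  empty zero    = refl
  empty (suc n) = refl
A₀ (suc k) p le = ≋-trans (A₀-step k p le)
  (≋-trans (⊕-cong (A₀ k p (≤-trans (n≤1+n k) le)) (⊛-congʳ (q^ suc k) top)) (≋-sym (invPoch-unfold k)))
  where
  top : A 0 (suc k) (suc k) ≋ invPoch (suc k)
  top = fixpoint-unique k (invPoch k) (A 0 (suc k) (suc k)) (invPoch (suc k))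
          (≋-trans (A₀-step k (suc k) ≤-refl) (⊕-congˡ (q^ suc k ⊛ A 0 (suc k) (suc k)) (A₀ k (suc k) (n≤1+n k))))
          (invPoch-unfold k)

A₁-step : ∀ k p → suc k ≤ p → A 1 p (suc k) ≋ A 1 p k ⊕ q^ suc k ⊛ (A 1 (suc k) (suc k) ⊕ invPoch k)
A₁-step k p pk = ≋-trans (partGF-step k (λ τ → gaussProd p τ 1))
  (⊕-congʳ (A 1 p k) (⊛-congʳ (q^ suc k)
    (≋-trans (partGF-cong (suc k) _ _ (λ τ le → gaussProd-t¹ p k τ le pk))
    (≋-trans (partGF-⊕ (suc k) (λ τ → gaussProd (suc k) τ 1) (λ τ → [ hd τ < suc k ] * gaussProd (suc k) τ 0))
             (⊕-congʳ (A 1 (suc k) (suc k))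
                (≋-trans (partGF-below k (λ τ → gaussProd (suc k) τ 0)) (A₀ k (suc k) (n≤1+n k))))))))

A₁ : ∀ k p → k ≤ p → A 1 p k ≋ closed₁ k
A₁ zero p _ = ≋-trans (partGF-empty _) empty
  where
  empty : weighted (λ τ → gaussProd p τ 1) [] ≋ 0S
  empty zero    = refl
  empty (suc n) = refl
A₁ (suc k) p le = begin
  A 1 p (suc k)                                ≈⟨ A₁-step k p le ⟩
  A 1 p k ⊕ q^ suc k ⊛ (X ⊕ invPoch k)
    ≈⟨ ⊕-cong (A₁ k p (≤-trans (n≤1+n k) le)) (⊛-congʳ (q^ suc k) (⊕-congˡ (invPoch k) top)) ⟩
  closed₁ k ⊕ q^ suc k ⊛ (closed₁ (suc k) ⊕ invPoch k)
    ≈⟨ regroup (closed₁ k) (q^ suc k) (closed₁ (suc k)) (invPoch k) ⟩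
  (closed₁ k ⊕ q^ suc k ⊛ invPoch k) ⊕ q^ suc k ⊛ closed₁ (suc k) ≈⟨ ≋-sym (closed₁-unfold k) ⟩
  closed₁ (suc k) ∎
  where
  X = A 1 (suc k) (suc k)
  top : X ≋ closed₁ (suc k)
  top = fixpoint-unique k (closed₁ k ⊕ q^ suc k ⊛ invPoch k) X (closed₁ (suc k))
    (≋-trans (A₁-step k (suc k) ≤-refl)
    (≋-trans (⊕-congˡ (q^ suc k ⊛ (X ⊕ invPoch k)) (A₁ k (suc k) (n≤1+n k)))
             (regroup (closed₁ k) (q^ suc k) X (invPoch k))))
    (closed₁-unfold k)

A₀-below : ∀ k → partGF (suc k) (λ τ → [ hd τ < k ] * gaussProd (suc k) τ 0) ≋ invPochPred k
A₀-below k = ≋-trans (partGF-cong (suc k) _ (λ τ → [ hd τ < suc k ] * ([ hd τ < k ] * G τ))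
                        (λ τ _ → trans (cong (_* G τ) ([<]-step (hd τ) k)) (*-assoc [ hd τ < suc k ] [ hd τ < k ] (G τ))))
             (≋-trans (partGF-below k (λ τ → [ hd τ < k ] * G τ)) (below k))
  where
  G : List ℕ → ℕ
  G τ = gaussProd (suc k) τ 0
  below : ∀ k → partGF k (λ τ → [ hd τ < k ] * gaussProd (suc k) τ 0) ≋ invPochPred k
  below zero    = ≋-trans (partGF-empty _) (monomial-0 0)
  below (suc j) = ≋-trans (partGF-below j (λ τ → gaussProd (suc (suc j)) τ 0))
                          (A₀ j (suc (suc j)) (≤-trans (n≤1+n j) (n≤1+n (suc j))))

A₂-step : ∀ k p → suc k ≤ p →
  A 2 p (suc k) ≋ A 2 p k ⊕ q^ suc k ⊛ (A 2 (suc k) (suc k) ⊕ closed₁ k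
                                       ⊕ partGF k (λ τ → [ suc k < p ] * gaussProd (suc k) τ 0) ⊕ invPochPred k)
A₂-step k p pk = ≋-trans (partGF-step k (λ τ → gaussProd p τ 2))
  (⊕-congʳ (A 2 p k) (⊛-congʳ (q^ suc k)
    (≋-trans (partGF-cong (suc k) _ (λ τ → P τ 2 + a τ * P τ 1 + a τ * (c * P τ 0) + [ hd τ < k ] * P τ 0)
                          (λ τ le → gaussProd-t² p k τ le pk))
    (≋-trans (partGF-⊕ (suc k) (λ τ → P τ 2 + a τ * P τ 1 + a τ * (c * P τ 0)) (λ τ → [ hd τ < k ] * P τ 0))
    (⊕-cong (≋-trans (partGF-⊕ (suc k) (λ τ → P τ 2 + a τ * P τ 1) (λ τ → a τ * (c * P τ 0)))
              (⊕-cong (≋-trans (partGF-⊕ (suc k) (λ τ → P τ 2) (λ τ → a τ * P τ 1))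
                         (⊕-congʳ (A 2 (suc k) (suc k))
                           (≋-trans (partGF-below k (λ τ → P τ 1)) (A₁ k (suc k) (n≤1+n k)))))
                      (partGF-below k (λ τ → c * P τ 0))))
            (A₀-below k))))))
  where
  P : List ℕ → ℕ → ℕ
  P τ = gaussProd (suc k) τ
  a : List ℕ → ℕ
  a τ = [ hd τ < suc k ]
  c = [ suc k < p ]

A₂ : ∀ k → ((p : ℕ) → k < p → A 2 p k ≋ closed₂⁺ k) × (A 2 k k ≋ closed₂ k)
A₂ zero = (λ p _ → ≋-trans (partGF-empty _) (≋-trans (empty p) (≋-sym (⊕-congʳ 0S (⊛-zeroʳ (q^ 0))))))
        , ≋-trans (partGF-empty _) (empty 0)
  where
  empty : ∀ p → weighted (λ τ → gaussProd p τ 2) [] ≋ 0S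
  empty p zero    = refl
  empty p (suc n) = refl
A₂ (suc k) = above , top
  where
  X = A 2 (suc k) (suc k)
  m = q^ suc k
  W′ = closed₂ (suc k)
  middle-= : partGF k (λ τ → [ suc k < suc k ] * gaussProd (suc k) τ 0) ≋ 0S
  middle-= = ≋-trans (partGF-cong k _ (λ _ → 0) (λ τ _ → cong (_* gaussProd (suc k) τ 0) ([<]-irrefl k))) (partGF-zero k)
  middle-> : ∀ p → suc k < p → partGF k (λ τ → [ suc k < p ] * gaussProd (suc k) τ 0) ≋ invPoch k
  middle-> p lt = ≋-trans (partGF-cong k _ (λ τ → gaussProd (suc k) τ 0)
                            (λ τ _ → trans (cong (_* gaussProd (suc k) τ 0) ([<]-yes (suc k) p lt)) (+-identityʳ _)))
                          (A₀ k (suc k) (n≤1+n k))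
  X-unfold : X ≋ (closed₂⁺ k ⊕ m ⊛ (closed₁ k ⊕ invPochPred k)) ⊕ m ⊛ X
  X-unfold = begin
    X                                          ≈⟨ A₂-step k (suc k) ≤-refl ⟩
    A 2 (suc k) k ⊕ m ⊛ (X ⊕ closed₁ k ⊕ partGF k (λ τ → [ suc k < suc k ] * gaussProd (suc k) τ 0) ⊕ invPochPred k)
      ≈⟨ ⊕-cong (proj₁ (A₂ k) (suc k) ≤-refl) (⊛-congʳ m (⊕-congˡ (invPochPred k) (⊕-congʳ (X ⊕ closed₁ k) middle-=))) ⟩
    closed₂⁺ k ⊕ m ⊛ (X ⊕ closed₁ k ⊕ 0S ⊕ invPochPred k)
      ≈⟨ solve 5 (λ v mm xx s z → v :+ mm :* (xx :+ s :+ con 0 :+ z) := (v :+ mm :* (s :+ z)) :+ mm :* xx)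
           ≋-refl (closed₂⁺ k) m X (closed₁ k) (invPochPred k) ⟩
    (closed₂⁺ k ⊕ m ⊛ (closed₁ k ⊕ invPochPred k)) ⊕ m ⊛ X ∎
  top : X ≋ W′
  top = fixpoint-unique k (closed₂⁺ k ⊕ m ⊛ (closed₁ k ⊕ invPochPred k)) X W′ X-unfold (closed₂-unfold k)
  above : (p : ℕ) → suc k < p → A 2 p (suc k) ≋ closed₂⁺ (suc k)
  above p lt = begin
    A 2 p (suc k)                              ≈⟨ A₂-step k p (<⇒≤ lt) ⟩
    A 2 p k ⊕ m ⊛ (X ⊕ closed₁ k ⊕ partGF k (λ τ → [ suc k < p ] * gaussProd (suc k) τ 0) ⊕ invPochPred k)
      ≈⟨ ⊕-cong (proj₁ (A₂ k) p (≤-trans (n≤1+n (suc k)) lt))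
                (⊛-congʳ m (⊕-congˡ (invPochPred k) (⊕-cong (⊕-congˡ (closed₁ k) top) (middle-> p lt)))) ⟩
    closed₂⁺ k ⊕ m ⊛ (W′ ⊕ closed₁ k ⊕ invPoch k ⊕ invPochPred k)
      ≈⟨ solve 6 (λ v mm w s zp z → v :+ mm :* (w :+ s :+ zp :+ z) := (v :+ mm :* (s :+ z)) :+ mm :* w :+ mm :* zp)
           ≋-refl (closed₂⁺ k) m W′ (closed₁ k) (invPoch k) (invPochPred k) ⟩
    (closed₂⁺ k ⊕ m ⊛ (closed₁ k ⊕ invPochPred k)) ⊕ m ⊛ W′ ⊕ m ⊛ invPoch k
      ≈⟨ ⊕-congˡ (m ⊛ invPoch k) (≋-sym (closed₂-unfold k)) ⟩
    W′ ⊕ m ⊛ invPoch k ∎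

-- Left-hand side: grouping partitions by their largest part m gives
--   [t^r] LHS = Σ_m q^(m(m+1)/2) A_r(m, m)

lhsTerm : ℕ → List ℕ → Series
lhsTerm r lam = monomial (weight lam) (prodGauss lam r)

lhsCoeff=sumOver : ∀ n r → lhsCoeff n r ≡ sumOver (decLists n n) (lhsTerm r) n
lhsCoeff=sumOver n r = go (decLists n n)
  where
  go : ∀ L → sum (map (λ lam → if weight lam ≡ᵇ n then prodGauss lam r else 0) L) ≡ sumOver L (lhsTerm r) n
  go []      = refl
  go (τ ∷ L) = cong (lhsTerm r τ n +_) (go L)

triangle=C2+ : ∀ m → m C 2 + m ≡ triangle m
triangle=C2+ zero    = refl
triangle=C2+ (suc m) =
  trans (cong (_+ suc m) (sym (nCk+nC[k+1]≡[n+1]C[k+1] m 1)))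
  (trans (cong (λ z → z + m C 2 + suc m) (nC1≡n m))
  (trans (cong (_+ suc m) (+-comm m (m C 2))) (cong (_+ suc m) (triangle=C2+ m))))

lhsTerm-cons : ∀ r j τ → lhsTerm r (j ∷ τ) ≋ q^ (triangle j) ⊛ weighted (λ τ′ → gaussProd j τ′ r) τ
lhsTerm-cons r j τ n =
  trans (cong₂ (λ d v → monomial d v n)
               (trans (sym (+-assoc (j C 2) j (size τ))) (cong (_+ size τ) (triangle=C2+ j)))
               (prodGauss=gaussProd j τ r))
        (monomial-+ (triangle j) (size τ) (gaussProd j τ r) n)

-- the partitions of decLists (f+1) K whose largest part is j
byLargest : ℕ → (List ℕ → Series) → ℕ → Series
byLargest f h zero    = h []
byLargest f h (suc j) = sumOver (decLists f (suc j)) (λ τ → h (suc j ∷ τ))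

sumOver-byLargest : ∀ f K h → sumOver (decLists (suc f) K) h ≋ λ n → Σ≤ K (λ j → byLargest f h j n)
sumOver-byLargest f zero    h n = +-identityʳ (h [] n)
sumOver-byLargest f (suc K) h n =
  trans (sumOver-decLists f K h n) (cong (_+ byLargest f h (suc K) n) (sumOver-byLargest f K h n))

lhsSeries : ℕ → Series
lhsSeries r = Σ∞ (λ m → q^ (triangle m) ⊛ A r m m)

byLargest-lhsTerm : ∀ r f j n → n ≤ suc f → byLargest f (lhsTerm r) j n ≡ (q^ (triangle j) ⊛ A r j j) n
byLargest-lhsTerm r f zero    n _ =
  sym (trans (⊛-identityˡ (A r 0 0) n) (partGF-empty (λ τ → gaussProd 0 τ r) n))
byLargest-lhsTerm r f (suc j) n n≤f =
  trans (sumOver-cong (decLists f (suc j)) (lhsTerm-cons r (suc j)) n)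
  (trans (sumOver-q^⊛ (decLists f (suc j)) t (weighted F) n)
         (q^⊛-agree t (partSum f (suc j) F) (A r (suc j) (suc j)) n
                    (λ m le → partSum-stable f (suc j) F m (m≤f m le))))
  where
  t = triangle (suc j)
  F : List ℕ → ℕ
  F τ = gaussProd (suc j) τ r
  m≤f : ∀ m → m + t ≤ n → m ≤ f
  m≤f m le = ≤-pred (≤-trans (<-≤-trans (m<m+n m (≤-trans (s≤s z≤n) (triangle-≥ (suc j)))) le) n≤f)

lhsCoeff=lhsSeries : ∀ r n → lhsCoeff n r ≡ lhsSeries r n
lhsCoeff=lhsSeries r zero =
  trans (lhsCoeff=sumOver 0 r) (trans (+-identityʳ _) (byLargest-lhsTerm r 0 0 0 z≤n))
lhsCoeff=lhsSeries r (suc n) =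
  trans (lhsCoeff=sumOver (suc n) r)
  (trans (sumOver-byLargest n (suc n) (lhsTerm r) (suc n))
         (Σ≤-cong′ (suc n) (λ j → byLargest-lhsTerm r n j (suc n) ≤-refl)))

lhsSeries-t⁰ : lhsSeries 0 ≋ euler 0
lhsSeries-t⁰ = Σ∞-cong (λ m → ≋-trans (⊛-congʳ (q^ (triangle m)) (A₀ m m ≤-refl))
                                     (⊛-congˡ (invPoch m) (q^-cong (sym (+-identityʳ (triangle m))))))

lhsSeries-t¹ : lhsSeries 1 ≋ h₁∞ ⊛ euler 0
lhsSeries-t¹ = begin
  lhsSeries 1                                  ≈⟨ Σ∞-cong (λ m → ⊛-congʳ (q^ (triangle m)) (A₁ m m ≤-refl)) ⟩
  Σ∞ (λ m → q^ (triangle m) ⊛ closed₁ m)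
    ≈⟨ Σ∞-tail _ (convergent-q^ triangle closed₁ triangle-≥) (⊛-zeroʳ (q^ 0)) ⟩
  Σ∞ (λ m → q^ (triangle (suc m)) ⊛ ((x ⊛ g1) ⊛ invPoch m)) ≈⟨ Σ∞-cong term ⟩
  Σ∞ (λ m → (q^ 2 ⊛ g1) ⊛ eulerTerm 1 m)
    ≈⟨ ≋-sym (Σ∞-⊛ (q^ 2 ⊛ g1) (eulerTerm 1) (convergent-eulerTerm 1)) ⟩
  (q^ 2 ⊛ g1) ⊛ euler 1                        ≈⟨ ⊛-congˡ (euler 1) (⊛-congʳ (q^ 2) (geom-split 0)) ⟩
  (q^ 2 ⊛ ((oneT ⊕ x) ⊛ geom 2)) ⊛ euler 1
    ≈⟨ solve 4 (λ m2 a g e → (m2 :* (a :* g)) :* e := (m2 :* g) :* (a :* e)) ≋-refl (q^ 2) (oneT ⊕ x) (geom 2) (euler 1) ⟩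
  h₁∞ ⊛ ((oneT ⊕ x) ⊛ euler 1)                 ≈⟨ ⊛-congʳ h₁∞ (≋-sym (euler-rec 0)) ⟩
  h₁∞ ⊛ euler 0 ∎
  where
  x = q^ 1
  g1 = geom 1
  exponent : ∀ t m → t + suc m + 1 ≡ 2 + (t + 1 * m)
  exponent = solve-∀
  term : ∀ m → q^ (triangle (suc m)) ⊛ ((x ⊛ g1) ⊛ invPoch m) ≋ (q^ 2 ⊛ g1) ⊛ eulerTerm 1 m
  term m = begin
    q^ (triangle (suc m)) ⊛ ((x ⊛ g1) ⊛ invPoch m)
      ≈⟨ solve 4 (λ t y a z → t :* ((y :* a) :* z) := ((t :* y) :* a) :* z) ≋-refl (q^ (triangle (suc m))) x g1 (invPoch m) ⟩
    ((q^ (triangle (suc m)) ⊛ x) ⊛ g1) ⊛ invPoch m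
      ≈⟨ ⊛-congˡ (invPoch m) (⊛-congˡ g1 (≋-trans (q^-+ (triangle (suc m)) 1)
           (≋-trans (q^-cong (exponent (triangle m) m)) (≋-sym (q^-+ 2 (triangle m + 1 * m)))))) ⟩
    ((q^ 2 ⊛ q^ (triangle m + 1 * m)) ⊛ g1) ⊛ invPoch m
      ≈⟨ solve 4 (λ a b c z → ((a :* b) :* c) :* z := (a :* c) :* (b :* z)) ≋-refl (q^ 2) (q^ (triangle m + 1 * m)) g1 (invPoch m) ⟩
    (q^ 2 ⊛ g1) ⊛ eulerTerm 1 m ∎

lhsSeries-t² : lhsSeries 2 ≋ h₂∞ ⊛ euler 0
lhsSeries-t² = begin
  lhsSeries 2                                  ≈⟨ Σ∞-cong (λ m → ⊛-congʳ (q^ (triangle m)) (proj₂ (A₂ m))) ⟩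
  Σ∞ (λ m → q^ (triangle m) ⊛ closed₂ m)
    ≈⟨ Σ∞-tail _ (convergent-q^ triangle closed₂ triangle-≥) (⊛-zeroʳ (q^ 0)) ⟩
  Σ∞ (λ m → q^ (triangle (suc m)) ⊛ closed₂ (suc m))
    ≈⟨ Σ∞-tail _ (convergent-q^ (λ m → triangle (suc m)) (λ m → closed₂ (suc m)) (λ m → ≤-trans (n≤1+n m) (triangle-≥ (suc m))))
               (⊛-zeroʳ (q^ 1)) ⟩
  Σ∞ (λ m → q^ (triangle (suc (suc m))) ⊛ (((x ⊛ g1) ⊛ geom 2) ⊛ invPoch m)) ≈⟨ Σ∞-cong term ⟩
  Σ∞ (λ m → ((q^ 4 ⊛ g1) ⊛ geom 2) ⊛ eulerTerm 2 m)
    ≈⟨ ≋-sym (Σ∞-⊛ ((q^ 4 ⊛ g1) ⊛ geom 2) (eulerTerm 2) (convergent-eulerTerm 2)) ⟩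
  ((q^ 4 ⊛ g1) ⊛ geom 2) ⊛ euler 2
    ≈⟨ ⊛-congˡ (euler 2) (⊛-cong (⊛-congʳ (q^ 4) (geom-split 0)) (geom-split 1)) ⟩
  ((q^ 4 ⊛ ((oneT ⊕ x) ⊛ geom 2)) ⊛ ((oneT ⊕ q^ 2) ⊛ geom 4)) ⊛ euler 2
    ≈⟨ solve 6 (λ m4 a g b h e → ((m4 :* (a :* g)) :* (b :* h)) :* e := (m4 :* (g :* h)) :* (a :* (b :* e)))
         ≋-refl (q^ 4) (oneT ⊕ x) (geom 2) (oneT ⊕ q^ 2) (geom 4) (euler 2) ⟩
  h₂∞ ⊛ ((oneT ⊕ x) ⊛ ((oneT ⊕ q^ 2) ⊛ euler 2))
    ≈⟨ ⊛-congʳ h₂∞ (≋-sym (≋-trans (euler-rec 0) (⊛-congʳ (oneT ⊕ x) (euler-rec 1)))) ⟩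
  h₂∞ ⊛ euler 0 ∎
  where
  x = q^ 1
  g1 = geom 1
  exponent : ∀ t m → t + suc m + suc (suc m) + 1 ≡ 4 + (t + 2 * m)
  exponent = solve-∀
  term : ∀ m → q^ (triangle (suc (suc m))) ⊛ (((x ⊛ g1) ⊛ geom 2) ⊛ invPoch m) ≋ ((q^ 4 ⊛ g1) ⊛ geom 2) ⊛ eulerTerm 2 m
  term m = begin
    q^ (triangle (suc (suc m))) ⊛ (((x ⊛ g1) ⊛ geom 2) ⊛ invPoch m)
      ≈⟨ solve 5 (λ t y a b z → t :* (((y :* a) :* b) :* z) := (((t :* y) :* a) :* b) :* z)
           ≋-refl (q^ (triangle (suc (suc m)))) x g1 (geom 2) (invPoch m) ⟩
    (((q^ (triangle (suc (suc m))) ⊛ x) ⊛ g1) ⊛ geom 2) ⊛ invPoch m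
      ≈⟨ ⊛-congˡ (invPoch m) (⊛-congˡ (geom 2) (⊛-congˡ g1 (≋-trans (q^-+ (triangle (suc (suc m))) 1)
           (≋-trans (q^-cong (exponent (triangle m) m)) (≋-sym (q^-+ 4 (triangle m + 2 * m))))))) ⟩
    (((q^ 4 ⊛ q^ (triangle m + 2 * m)) ⊛ g1) ⊛ geom 2) ⊛ invPoch m
      ≈⟨ solve 5 (λ a b c d z → (((a :* b) :* c) :* d) :* z := ((a :* c) :* d) :* (b :* z))
           ≋-refl (q^ 4) (q^ (triangle m + 2 * m)) g1 (geom 2) (invPoch m) ⟩
    ((q^ 4 ⊛ g1) ⊛ geom 2) ⊛ eulerTerm 2 m ∎

-- h_r(q², q⁴, …) for r = 0, 1, 2; both sides equal h_r · 1/(q;q²)_∞ up to degree n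
h∞ : ℕ → Series
h∞ zero          = oneT
h∞ (suc zero)    = h₁∞
h∞ (suc (suc _)) = h₂∞

lhs-closed : ∀ r → r ≤ 2 → lhsSeries r ≋ h∞ r ⊛ euler 0
lhs-closed zero                _ = ≋-trans lhsSeries-t⁰ (≋-sym (⊛-identityˡ (euler 0)))
lhs-closed (suc zero)          _ = lhsSeries-t¹
lhs-closed (suc (suc zero))    _ = lhsSeries-t²
lhs-closed (suc (suc (suc r))) (s≤s (s≤s ()))

rhs-closed : ∀ r → r ≤ 2 → ∀ n → rhsCoeff n r ≡ (invOddPoch n ⊛ h∞ r) n
rhs-closed zero                _ n = trans (rhs-t⁰ n) (sym (≋-trans (⊛-comm (invOddPoch n) oneT) (⊛-identityˡ (invOddPoch n)) n))
rhs-closed (suc zero)          _ n = rhs-t¹ n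
rhs-closed (suc (suc zero))    _ n = rhs-t² n
rhs-closed (suc (suc (suc r))) (s≤s (s≤s ()))

euler-truncate : ∀ G n → (G ⊛ euler 0) n ≡ (invOddPoch n ⊛ G) n
euler-truncate G n = trans (⊛-cong≈ (≈-refl {G}) (euler≈invOddPoch n) n ≤-refl) (⊛-comm G (invOddPoch n) n)

theorem3p4 : (r : ℕ) → r ≤ 2 → (n : ℕ) → lhsCoeff n r ≡ rhsCoeff n r
theorem3p4 r r≤2 n =
  trans (lhsCoeff=lhsSeries r n)                  -- group partitions by largest part
  (trans (lhs-closed r r≤2 n)                     -- closed forms of A_r, Euler's recursion
  (trans (euler-truncate (h∞ r) n)                -- Euler's identity
         (sym (rhs-closed r r≤2 n))))             -- expansion of the product
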